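{- Let $n$ be a positive integer. Consider all simple jump paths in dimension $2$ from $(n+1,n+1)$ to $(0,0)$, and the multiset of gap sums of all gap vectors occurring in all of these paths (each path contributing one gap vector per step). For an integer $v\ge 0$, let $P_n(v)$ be the number of gap sums equal to $v$ in this multiset divided by the total number of gap vectors in this multiset. Then $P_n(0)=P_n(1)=0$, and for every fixed integer $v\ge 2$, \[\lim_{n\to\infty} P_n(v) \;=\; \frac{v-1}{2^{v}}.\]
   Context: A simple jump path in dimension $2$ of length $k$ starting at $(a_1,a_2)$ (with $a_1,a_2$ positive integers) is a sequence of lattice points $(x_{0,1},x_{0,2}),\dots,(x_{k,1},x_{k,2})$ in $\mathbb{Z}_{\ge 0}^2$ with $(x_{0,1},x_{0,2})=(a_1,a_2)$, $(x_{k,1},x_{k,2})=(0,0)$, and $x_{i,j}>x_{i+1,j}$ for all $i\in\{0,\dots,k-1\}$ and $j\in\{1,2\}$. Each step from $(x_{i,1},x_{i,2})$ to $(x_{i+1,1},x_{i+1,2})$ has gap vector $(x_{i,1}-x_{i+1,1},\,x_{i,2}-x_{i+1,2})$, and the gap sum of that step is the sum of the two components of its gap vector. A path of length $k$ has $k$ gap vectors (including the final step into the origin). -}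

module Defs where

open import Data.Nat using (ℕ; zero; suc; _+_; _∸_; _≟_)
open import Data.Product using (_×_; _,_)
open import Data.List using (List; []; _∷_; map; concat; upTo; length; filter)
open import Data.Integer using (+_)
open import Data.Rational using (ℚ; 0ℚ; _/_)

Point : Set
Point = ℕ × ℕ

-- A simple jump path is represented by its list of points x₀, …, x_k.
-- pathsF fuel a b : all simple jump paths starting at (a , b) and ending at (0 , 0),
-- i.e. point sequences with strictly decreasing coordinates in both components.
-- The fuel (= a + 1 suffices) only serves termination checking.
pathsF : ℕ → ℕ → ℕ → List (List Point)
pathsF zero    _       _       = []
pathsF (suc f) zero    zero    = ((0 , 0) ∷ []) ∷ []
pathsF (suc f) zero    (suc b) = []
pathsF (suc f) (suc a) zero    = []
pathsF (suc f) (suc a) (suc b) =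
  concat (map (λ c → concat (map (λ d → map ((suc a , suc b) ∷_) (pathsF f c d))
                                 (upTo (suc b))))
              (upTo (suc a)))

jumpPaths : ℕ → ℕ → List (List Point)
jumpPaths a b = pathsF (suc a) a b

gapSums : List Point → List ℕ
gapSums []                                = []
gapSums (_ ∷ [])                          = []
gapSums ((x₁ , x₂) ∷ (y₁ , y₂) ∷ rest) =
  ((x₁ ∸ y₁) + (x₂ ∸ y₂)) ∷ gapSums ((y₁ , y₂) ∷ rest)

gapSumMultiset : ℕ → List ℕ
gapSumMultiset n = concat (map gapSums (jumpPaths (suc n) (suc n)))

countGap : ℕ → ℕ → ℕ
countGap n v = length (filter (_≟ v) (gapSumMultiset n))

-- a / b as a rational number (with the convention a / 0 = 0, never used here
-- since the multisets considered are non-empty and 2^v > 0)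
ratio : ℕ → ℕ → ℚ
ratio a zero    = 0ℚ
ratio a (suc b) = (+ a) / suc b

P : ℕ → ℕ → ℚ
P n v = ratio (countGap n v) (length (gapSumMultiset n))

module Submission where

-- Cutting a path after its first step gives recurrences over the rectangle below the start point,
-- solved in closed form with C(i + j , i): from (a + 1 , b + 1) there are C(a + b , a) paths, and
-- over all paths from (a , b) the steps with gap vector (g₁ , g₂) are as many as the points on all
-- paths from (a − g₁ , b − g₂). For the start (M + 2 , M + 2) the multiset then has
-- (2M + 1)(M + 3) C(2M , M) / (M + 1) ≈ 2M C(2M , M) elements, while each of the v − 1 gap vectors
-- with gap sum v occurs about 2M C(2M − v , M − g₁) times. A unit step from (i , j) changes
-- C(i + j , i) by the factor (i + j + 1) / (i + 1) ≈ 2, so by Bernoulli's inequality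
-- 2^v C(2M − v , M − g₁) = C(2M , M) (1 + O(v² / M)), and the frequency of v tends to (v − 1) / 2^v.

open import Defs

module Counting where

  open import Data.Nat using (ℕ; zero; suc; _+_; _*_; _∸_; _≤_; _<_; z≤n; s≤s; _≟_)
  open import Data.Nat.Properties hiding (_≟_)
  open import Data.Nat.Tactic.RingSolver using (solve-∀)
  open import Data.Product using (∃; _,_)
  open import Data.List using (List; []; _∷_; _++_; map; concat; upTo; applyUpTo; length; filter)
  open import Data.List.Properties using (length-++; length-map; filter-++; filter-accept; filter-reject; ++-assoc)
  open import Data.List.Relation.Unary.All using (All; []; _∷_; universal)
  open import Data.List.Relation.Unary.All.Properties using (concat⁺; map⁺)
  open import Function using (_∘_)
  open import Relation.Binary.PropositionalEquality
  open import Relation.Nullary using (yes; no; contradiction)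
  open ≡-Reasoning

  Σ : ℕ → (ℕ → ℕ) → ℕ
  Σ zero    f = 0
  Σ (suc n) f = f 0 + Σ n (f ∘ suc)

  Σ² : ℕ → ℕ → (ℕ → ℕ → ℕ) → ℕ
  Σ² a b f = Σ a (λ c → Σ b (f c))

  Σ-cong : ∀ n {f g} → (∀ c → c < n → f c ≡ g c) → Σ n f ≡ Σ n g
  Σ-cong zero    eq = refl
  Σ-cong (suc n) eq = cong₂ _+_ (eq 0 (s≤s z≤n)) (Σ-cong n (λ c c<n → eq (suc c) (s≤s c<n)))

  Σ²-cong : ∀ a b {f g} → (∀ c d → c < a → d < b → f c d ≡ g c d) → Σ² a b f ≡ Σ² a b g
  Σ²-cong a b eq = Σ-cong a (λ c c<a → Σ-cong b (λ d d<b → eq c d c<a d<b))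

  Σ-zero : ∀ n → Σ n (λ _ → 0) ≡ 0
  Σ-zero zero    = refl
  Σ-zero (suc n) = Σ-zero n

  Σ²-zero : ∀ a b → Σ² a b (λ _ _ → 0) ≡ 0
  Σ²-zero a b = trans (Σ-cong a (λ _ _ → Σ-zero b)) (Σ-zero a)

  Σ-const : ∀ n k → Σ n (λ _ → k) ≡ n * k
  Σ-const zero    k = refl
  Σ-const (suc n) k = cong (k +_) (Σ-const n k)

  Σ-snoc : ∀ n f → Σ (suc n) f ≡ Σ n f + f n
  Σ-snoc zero    f = +-comm (f 0) 0
  Σ-snoc (suc n) f = begin
    f 0 + Σ (suc n) (f ∘ suc)    ≡⟨ cong (f 0 +_) (Σ-snoc n (f ∘ suc)) ⟩
    f 0 + (Σ n (f ∘ suc) + f (suc n)) ≡⟨ +-assoc (f 0) _ _ ⟨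
    f 0 + Σ n (f ∘ suc) + f (suc n) ∎

  Σ-+ : ∀ n f g → Σ n (λ c → f c + g c) ≡ Σ n f + Σ n g
  Σ-+ zero    f g = refl
  Σ-+ (suc n) f g = begin
    f 0 + g 0 + Σ n (λ c → f (suc c) + g (suc c))
      ≡⟨ cong (f 0 + g 0 +_) (Σ-+ n (f ∘ suc) (g ∘ suc)) ⟩
    f 0 + g 0 + (Σ n (f ∘ suc) + Σ n (g ∘ suc))
      ≡⟨ interchange (f 0) (g 0) _ _ ⟩
    f 0 + Σ n (f ∘ suc) + (g 0 + Σ n (g ∘ suc)) ∎
    where
    interchange : ∀ a b c d → a + b + (c + d) ≡ a + c + (b + d)
    interchange = solve-∀

  Σ-*ˡ : ∀ n k f → Σ n (λ c → k * f c) ≡ k * Σ n f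
  Σ-*ˡ zero    k f = sym (*-zeroʳ k)
  Σ-*ˡ (suc n) k f = trans (cong (k * f 0 +_) (Σ-*ˡ n k (f ∘ suc))) (sym (*-distribˡ-+ k (f 0) _))

  Σ-*ʳ : ∀ n k f → Σ n (λ c → f c * k) ≡ Σ n f * k
  Σ-*ʳ n k f = begin
    Σ n (λ c → f c * k)  ≡⟨ Σ-cong n (λ c _ → *-comm (f c) k) ⟩
    Σ n (λ c → k * f c)  ≡⟨ Σ-*ˡ n k f ⟩
    k * Σ n f            ≡⟨ *-comm k _ ⟩
    Σ n f * k            ∎

  Σ-swap : ∀ m n (h : ℕ → ℕ → ℕ) → Σ² m n h ≡ Σ² n m (λ d c → h c d)
  Σ-swap zero    n h = sym (Σ-zero n)
  Σ-swap (suc m) n h = begin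
    Σ n (h 0) + Σ² m n (h ∘ suc)                    ≡⟨ cong (Σ n (h 0) +_) (Σ-swap m n (h ∘ suc)) ⟩
    Σ n (h 0) + Σ² n m (λ d c → h (suc c) d)        ≡⟨ Σ-+ n (h 0) _ ⟨
    Σ² n (suc m) (λ d c → h c d)                    ∎

  Σ-mono : ∀ n {f g} → (∀ c → c < n → f c ≤ g c) → Σ n f ≤ Σ n g
  Σ-mono zero    le = z≤n
  Σ-mono (suc n) le = +-mono-≤ (le 0 (s≤s z≤n)) (Σ-mono n (λ c c<n → le (suc c) (s≤s c<n)))

  telescope : (f g h : ℕ → ℕ) → f 0 ≡ g 0 → (∀ n → f (suc n) + g n ≡ f n + g (suc n) + h n) →
              ∀ n → f n ≡ g n + Σ n h
  telescope f g h f0≡g0 step zero    = trans f0≡g0 (sym (+-identityʳ (g 0)))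
  telescope f g h f0≡g0 step (suc n) = +-cancelʳ-≡ (g n) _ _ (begin
    f (suc n) + g n                          ≡⟨ step n ⟩
    f n + g (suc n) + h n                    ≡⟨ cong (λ x → x + g (suc n) + h n) (telescope f g h f0≡g0 step n) ⟩
    g n + Σ n h + g (suc n) + h n            ≡⟨ rearrange (g n) (Σ n h) (g (suc n)) (h n) ⟩
    g (suc n) + (Σ n h + h n) + g n          ≡⟨ cong (λ x → g (suc n) + x + g n) (Σ-snoc n h) ⟨
    g (suc n) + Σ (suc n) h + g n            ∎)
    where
    rearrange : ∀ a s b c → a + s + b + c ≡ b + (s + c) + a
    rearrange = solve-∀

  -- The last hypothesis says that F − G has mixed second differences h, written without subtraction.
  telescope² : (F G h : ℕ → ℕ → ℕ) → (∀ a → F a 0 ≡ G a 0) → (∀ b → F 0 b ≡ G 0 b) →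
               (∀ a b → F (suc a) (suc b) + F a b + G (suc a) b + G a (suc b)
                      ≡ F (suc a) b + F a (suc b) + G (suc a) (suc b) + G a b + h a b) →
               ∀ a b → F a b ≡ G a b + Σ² a b h
  telescope² F G h F≡G₀ F₀≡G step a b =
    telescope (λ a → F a b) (λ a → G a b) (λ a → Σ b (h a)) (F₀≡G b) column a
    where
    column : ∀ a → F (suc a) b + G a b ≡ F a b + G (suc a) b + Σ b (h a)
    column a = telescope (λ b → F (suc a) b + G a b) (λ b → F a b + G (suc a) b) (h a)
      (trans (cong₂ _+_ (F≡G₀ (suc a)) (sym (F≡G₀ a))) (+-comm (G (suc a) 0) (F a 0)))
      (λ b → trans (regroupˡ (F (suc a) (suc b)) (G a (suc b)) (F a b) (G (suc a) b))
            (trans (step a b) (regroupʳ (F (suc a) b) (F a (suc b)) (G (suc a) (suc b)) (G a b) (h a b))))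
      b
      where
      regroupˡ : ∀ p q r s → p + q + (r + s) ≡ p + r + s + q
      regroupˡ = solve-∀
      regroupʳ : ∀ p q r s t → p + q + r + s + t ≡ p + s + (q + r) + t
      regroupʳ = solve-∀

  -- binom i j is the binomial coefficient (i + j choose i).
  binom : ℕ → ℕ → ℕ
  binom zero    j       = 1
  binom (suc i) zero    = 1
  binom (suc i) (suc j) = binom i (suc j) + binom (suc i) j

  binom-n0 : ∀ i → binom i 0 ≡ 1
  binom-n0 zero    = refl
  binom-n0 (suc i) = refl

  binom-n1 : ∀ i → binom i 1 ≡ suc i
  binom-n1 zero    = refl
  binom-n1 (suc i) = trans (cong (_+ 1) (binom-n1 i)) (+-comm (suc i) 1)

  binom-1n : ∀ j → binom 1 j ≡ suc j
  binom-1n zero    = refl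
  binom-1n (suc j) = cong suc (binom-1n j)

  binom-Σ² : ∀ a b → binom a b ≡ 1 + Σ² a b binom
  binom-Σ² = telescope² binom (λ _ _ → 1) binom binom-n0 (λ _ → refl)
    (λ a b → regroup (binom a (suc b)) (binom (suc a) b) (binom a b))
    where
    regroup : ∀ x y z → x + y + z + 1 + 1 ≡ y + x + 1 + 1 + z
    regroup = solve-∀

  binom-Σ²-weighted : ∀ a b → suc (a + b) * binom a b + 1
                    ≡ binom (suc a) (suc b) + Σ² a b (λ c d → suc (c + d) * binom c d)
  binom-Σ²-weighted = telescope² (λ a b → suc (a + b) * binom a b + 1) (λ a b → binom (suc a) (suc b))
    (λ c d → suc (c + d) * binom c d) on-a-axis on-b-axis
    (λ a b → regroup a b (binom a (suc b)) (binom (suc a) b) (binom a b)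
                         (binom (suc (suc a)) (suc b)) (binom (suc a) (suc (suc b))))
    where
    on-a-axis : ∀ a → suc (a + 0) * binom a 0 + 1 ≡ binom (suc a) 1
    on-a-axis a = begin
      suc (a + 0) * binom a 0 + 1  ≡⟨ cong (λ x → suc (a + 0) * x + 1) (binom-n0 a) ⟩
      suc (a + 0) * 1 + 1          ≡⟨ lemma a ⟩
      suc (suc a)                  ≡⟨ binom-n1 (suc a) ⟨
      binom (suc a) 1              ∎
      where
      lemma : ∀ a → suc (a + 0) * 1 + 1 ≡ suc (suc a)
      lemma = solve-∀
    on-b-axis : ∀ b → suc b * 1 + 1 ≡ binom 1 (suc b)
    on-b-axis b = trans (lemma b) (sym (binom-1n (suc b)))
      where
      lemma : ∀ b → suc b * 1 + 1 ≡ suc (suc b)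
      lemma = solve-∀
    regroup : ∀ a b p q z u w →
      suc (suc a + suc b) * (p + q) + 1 + (suc (a + b) * z + 1) + u + w
      ≡ suc (suc a + b) * q + 1 + (suc (a + suc b) * p + 1) + (w + u) + (p + q) + suc (a + b) * z
    regroup = solve-∀

  pathCount : ℕ → ℕ → ℕ
  pathCount zero    zero    = 1
  pathCount (suc a) (suc b) = binom a b
  pathCount _       _       = 0

  -- The simple jump paths from (a , b) are pathCount a b many and visit pointCount a b points in total;
  -- innerPoints a b counts the points other than the endpoints on the paths from (a + 1 , b + 1).
  innerPoints : ℕ → ℕ → ℕ
  innerPoints (suc a) (suc b) = suc (a + b) * binom a b
  innerPoints _       _       = 0

  pointCount : ℕ → ℕ → ℕ
  pointCount zero    zero    = 1
  pointCount (suc a) (suc b) = 2 * binom a b + innerPoints a b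
  pointCount _       _       = 0

  pathCount-Σ² : ∀ a b → pathCount (suc a) (suc b) ≡ Σ² (suc a) (suc b) pathCount
  pathCount-Σ² a b = begin
    binom a b                                    ≡⟨ binom-Σ² a b ⟩
    1 + Σ² a b binom                             ≡⟨ cong (λ x → 1 + x + Σ² a b binom) (Σ-zero b) ⟨
    1 + Σ b (λ _ → 0) + Σ² a b binom             ∎

  innerPoints-Σ² : ∀ a b → innerPoints a b + 1 ≡ binom a b + Σ² a b innerPoints
  innerPoints-Σ² zero    b       = refl
  innerPoints-Σ² (suc a) zero    = cong suc (sym (Σ-zero (suc a)))
  innerPoints-Σ² (suc a) (suc b) = begin
    suc (a + b) * binom a b + 1                                      ≡⟨ binom-Σ²-weighted a b ⟩
    binom (suc a) (suc b) + Σ² a b (λ c d → suc (c + d) * binom c d)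
      ≡⟨ cong (λ x → binom (suc a) (suc b) + (x + Σ² a b (λ c d → suc (c + d) * binom c d))) (Σ-zero (suc b)) ⟨
    binom (suc a) (suc b) + Σ² (suc a) (suc b) innerPoints           ∎

  pointCount-Σ² : ∀ a b → pointCount a b ≡ pathCount a b + Σ² a b pointCount
  pointCount-Σ² zero    zero    = refl
  pointCount-Σ² zero    (suc b) = refl
  pointCount-Σ² (suc a) zero    = sym (Σ-zero (suc a))
  pointCount-Σ² (suc a) (suc b) = +-cancelʳ-≡ 1 _ _ (begin
    2 * binom a b + innerPoints a b + 1         ≡⟨ +-assoc (2 * binom a b) _ 1 ⟩
    2 * binom a b + (innerPoints a b + 1)       ≡⟨ cong (2 * binom a b +_) (innerPoints-Σ² a b) ⟩
    2 * binom a b + (binom a b + Sᵢ)            ≡⟨ cong (λ x → 2 * x + (x + Sᵢ)) (binom-Σ² a b) ⟩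
    2 * (1 + Sₚ) + ((1 + Sₚ) + Sᵢ)              ≡⟨ regroup Sₚ Sᵢ ⟩
    (1 + Sₚ) + (1 + (2 * Sₚ + Sᵢ)) + 1          ≡⟨ cong₂ (λ x y → x + (1 + y) + 1) (binom-Σ² a b) Σ²-pointCount ⟨
    binom a b + (1 + Σ² a b (λ c d → pointCount (suc c) (suc d))) + 1
      ≡⟨ cong (λ x → binom a b + (1 + x + Σ² a b (λ c d → pointCount (suc c) (suc d))) + 1) (Σ-zero b) ⟨
    binom a b + Σ² (suc a) (suc b) pointCount + 1 ∎)
    where
    Sₚ = Σ² a b binom
    Sᵢ = Σ² a b innerPoints
    regroup : ∀ x y → 2 * (1 + x) + ((1 + x) + y) ≡ (1 + x) + (1 + (2 * x + y)) + 1
    regroup = solve-∀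
    Σ²-pointCount : Σ² a b (λ c d → pointCount (suc c) (suc d)) ≡ 2 * Sₚ + Sᵢ
    Σ²-pointCount = begin
      Σ² a b (λ c d → 2 * binom c d + innerPoints c d)
        ≡⟨ Σ-cong a (λ c _ → Σ-+ b (λ d → 2 * binom c d) (innerPoints c)) ⟩
      Σ a (λ c → Σ b (λ d → 2 * binom c d) + Σ b (innerPoints c))
        ≡⟨ Σ-+ a _ _ ⟩
      Σ a (λ c → Σ b (λ d → 2 * binom c d)) + Sᵢ
        ≡⟨ cong (_+ Sᵢ) (trans (Σ-cong a (λ c _ → Σ-*ˡ b 2 (binom c))) (Σ-*ˡ a 2 _)) ⟩
      2 * Sₚ + Sᵢ ∎

  shift : ℕ → (ℕ → ℕ) → ℕ → ℕ
  shift zero    h a       = h a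
  shift (suc g) h zero    = 0
  shift (suc g) h (suc a) = shift g h a

  shift² : ℕ → ℕ → (ℕ → ℕ → ℕ) → ℕ → ℕ → ℕ
  shift² g₁ g₂ F a b = shift g₁ (λ c → shift g₂ (F c) b) a

  shift-cong : ∀ g a {h k} → (∀ x → h x ≡ k x) → shift g h a ≡ shift g k a
  shift-cong zero    a       eq = eq a
  shift-cong (suc g) zero    eq = refl
  shift-cong (suc g) (suc a) eq = shift-cong g a eq

  shift-+ : ∀ g a h k → shift g (λ x → h x + k x) a ≡ shift g h a + shift g k a
  shift-+ zero    a       h k = refl
  shift-+ (suc g) zero    h k = refl
  shift-+ (suc g) (suc a) h k = shift-+ g a h k

  shift-∸ : ∀ g a h → h 0 ≡ 0 → shift g h a ≡ h (a ∸ g)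
  shift-∸ zero    a       h h0≡0 = refl
  shift-∸ (suc g) zero    h h0≡0 = sym h0≡0
  shift-∸ (suc g) (suc a) h h0≡0 = shift-∸ g a h h0≡0

  Σ-shift : ∀ g n h → Σ n (shift g h) ≡ Σ (n ∸ g) h
  Σ-shift zero    n       h = refl
  Σ-shift (suc g) zero    h = refl
  Σ-shift (suc g) (suc n) h = Σ-shift g n h

  shift²-+ : ∀ g₁ g₂ a b F G → shift² g₁ g₂ (λ p q → F p q + G p q) a b ≡ shift² g₁ g₂ F a b + shift² g₁ g₂ G a b
  shift²-+ g₁ g₂ a b F G =
    trans (shift-cong g₁ a (λ c → shift-+ g₂ b (F c) (G c))) (shift-+ g₁ a _ _)

  Σ²-shift² : ∀ g₁ g₂ a b F → Σ² a b (shift² g₁ g₂ F) ≡ Σ² (a ∸ g₁) (b ∸ g₂) F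
  Σ²-shift² g₁ g₂ a b F = begin
    Σ² a b (shift² g₁ g₂ F)                                  ≡⟨ Σ-swap a b _ ⟩
    Σ b (λ d → Σ a (shift g₁ (λ c → shift g₂ (F c) d)))      ≡⟨ Σ-cong b (λ d _ → Σ-shift g₁ a _) ⟩
    Σ b (λ d → Σ (a ∸ g₁) (λ c → shift g₂ (F c) d))          ≡⟨ Σ-swap b (a ∸ g₁) _ ⟩
    Σ (a ∸ g₁) (λ c → Σ b (shift g₂ (F c)))                  ≡⟨ Σ-cong (a ∸ g₁) (λ c _ → Σ-shift g₂ b (F c)) ⟩
    Σ² (a ∸ g₁) (b ∸ g₂) F                                   ∎

  shift²-Σ² : ∀ g₁ g₂ a b F → shift² g₁ g₂ (λ p q → Σ² p q F) a b ≡ Σ² (a ∸ g₁) (b ∸ g₂) F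
  shift²-Σ² g₁ g₂ a b F = begin
    shift g₁ (λ c → shift g₂ (λ q → Σ² c q F) b) a  ≡⟨ shift-cong g₁ a (λ c → shift-∸ g₂ b _ (Σ-zero c)) ⟩
    shift g₁ (λ c → Σ² c (b ∸ g₂) F) a              ≡⟨ shift-∸ g₁ a _ refl ⟩
    Σ² (a ∸ g₁) (b ∸ g₂) F                          ∎

  δ : ℕ → ℕ → ℕ
  δ zero    zero    = 1
  δ (suc x) (suc y) = δ x y
  δ _       _       = 0

  shift-unfold : ∀ g n h → shift g h n ≡ δ n g * h 0 + shift (suc g) (h ∘ suc) n
  shift-unfold zero    zero    h = sym (trans (+-identityʳ (1 * h 0)) (*-identityˡ (h 0)))
  shift-unfold zero    (suc n) h = refl
  shift-unfold (suc g) zero    h = refl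
  shift-unfold (suc g) (suc n) h = shift-unfold g n h

  Σ-δ : ∀ n g h → Σ n (λ c → δ (n ∸ c) (suc g) * h c) ≡ shift (suc g) h n
  Σ-δ zero    g h = refl
  Σ-δ (suc n) g h = trans (cong (δ n g * h 0 +_) (Σ-δ n g (h ∘ suc))) (sym (shift-unfold g n h))

  Σ²-δ : ∀ g₁ g₂ a b F →
         Σ² a b (λ c d → δ (a ∸ c) (suc g₁) * δ (b ∸ d) (suc g₂) * F c d) ≡ shift² (suc g₁) (suc g₂) F a b
  Σ²-δ g₁ g₂ a b F = begin
    Σ² a b (λ c d → δ (a ∸ c) (suc g₁) * δ (b ∸ d) (suc g₂) * F c d)
      ≡⟨ Σ-cong a (λ c _ → trans (Σ-cong b (λ d _ → *-assoc (δ (a ∸ c) (suc g₁)) _ _))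
                                 (Σ-*ˡ b (δ (a ∸ c) (suc g₁)) (λ d → δ (b ∸ d) (suc g₂) * F c d))) ⟩
    Σ a (λ c → δ (a ∸ c) (suc g₁) * Σ b (λ d → δ (b ∸ d) (suc g₂) * F c d))
      ≡⟨ Σ-cong a (λ c _ → cong (δ (a ∸ c) (suc g₁) *_) (Σ-δ b g₂ (F c))) ⟩
    Σ a (λ c → δ (a ∸ c) (suc g₁) * shift (suc g₂) (F c) b)
      ≡⟨ Σ-δ a g₁ _ ⟩
    shift² (suc g₁) (suc g₂) F a b ∎

  -- Over all simple jump paths from (a , b) there are stepCount g₁ g₂ a b steps with gap vector (g₁ , g₂).
  stepCount : ℕ → ℕ → ℕ → ℕ → ℕ
  stepCount g₁ g₂ = shift² g₁ g₂ pointCount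

  stepCount-Σ² : ∀ g₁ g₂ a b → stepCount (suc g₁) (suc g₂) a b
               ≡ Σ² a b (λ c d → δ (a ∸ c) (suc g₁) * δ (b ∸ d) (suc g₂) * pathCount c d
                                 + stepCount (suc g₁) (suc g₂) c d)
  stepCount-Σ² g₁ g₂ a b = begin
    shift² (suc g₁) (suc g₂) pointCount a b
      ≡⟨ shift-cong (suc g₁) a (λ c → shift-cong (suc g₂) b (pointCount-Σ² c)) ⟩
    shift² (suc g₁) (suc g₂) (λ p q → pathCount p q + Σ² p q pointCount) a b
      ≡⟨ shift²-+ (suc g₁) (suc g₂) a b pathCount _ ⟩
    shift² (suc g₁) (suc g₂) pathCount a b + shift² (suc g₁) (suc g₂) (λ p q → Σ² p q pointCount) a b
      ≡⟨ cong₂ _+_ (Σ²-δ g₁ g₂ a b pathCount) (trans (Σ²-shift² (suc g₁) (suc g₂) a b pointCount)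
                                                     (sym (shift²-Σ² (suc g₁) (suc g₂) a b pointCount))) ⟨
    Σ² a b (λ c d → δ (a ∸ c) (suc g₁) * δ (b ∸ d) (suc g₂) * pathCount c d) + Σ² a b (stepCount (suc g₁) (suc g₂))
      ≡⟨ trans (Σ-cong a (λ c _ → Σ-+ b _ _)) (Σ-+ a _ _) ⟨
    Σ² a b (λ c d → δ (a ∸ c) (suc g₁) * δ (b ∸ d) (suc g₂) * pathCount c d + stepCount (suc g₁) (suc g₂) c d) ∎

  -- Σ⁺ v F sums F g₁ g₂ over the gap vectors (g₁ , g₂) with g₁ , g₂ ≥ 1 and gap sum g₁ + g₂ = v.
  Σ⁺ : ℕ → (ℕ → ℕ → ℕ) → ℕ
  Σ⁺ (suc (suc n)) F = Σ (suc n) (λ i → F (suc i) (suc (n ∸ i)))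
  Σ⁺ _             F = 0

  gapSumCount : ℕ → ℕ → ℕ → ℕ
  gapSumCount v a b = Σ⁺ v (λ g₁ g₂ → stepCount g₁ g₂ a b)

  Σ-δ-convolution : ∀ x y n → Σ (suc n) (λ i → δ x i * δ y (n ∸ i)) ≡ δ (x + y) n
  Σ-δ-convolution zero    y n       = trans (cong₂ _+_ (+-identityʳ (δ y n)) (Σ-zero n)) (+-identityʳ (δ y n))
  Σ-δ-convolution (suc x) y zero    = refl
  Σ-δ-convolution (suc x) y (suc n) = Σ-δ-convolution x y n

  Σ⁺-δ : ∀ x y v → Σ⁺ v (λ g₁ g₂ → δ (suc x) g₁ * δ (suc y) g₂) ≡ δ (suc x + suc y) v
  Σ⁺-δ x y zero          = refl
  Σ⁺-δ x y (suc zero)    rewrite +-suc x y = refl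
  Σ⁺-δ x y (suc (suc n)) rewrite +-suc x y = Σ-δ-convolution x y n

  ∸-suc : ∀ {a c} → c < a → a ∸ c ≡ suc (a ∸ suc c)
  ∸-suc {suc a} (s≤s c≤a) = +-∸-assoc 1 c≤a

  δ-gap : ∀ v {a b c d} → c < a → d < b →
          δ ((a ∸ c) + (b ∸ d)) v ≡ Σ⁺ v (λ g₁ g₂ → δ (a ∸ c) g₁ * δ (b ∸ d) g₂)
  δ-gap v c<a d<b rewrite ∸-suc c<a | ∸-suc d<b = sym (Σ⁺-δ _ _ v)

  Σ²-vanishing-gapSum : ∀ v a b → (∀ F → Σ⁺ v F ≡ 0) →
    Σ² a b (λ c d → δ ((a ∸ c) + (b ∸ d)) v * pathCount c d + gapSumCount v c d) ≡ 0
  Σ²-vanishing-gapSum v a b vanish = trans (Σ²-cong a b {g = λ _ _ → 0} (λ c d c<a d<b →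
    cong₂ (λ x y → x * pathCount c d + y) (trans (δ-gap v c<a d<b) (vanish _)) (vanish _))) (Σ²-zero a b)

  gapSumCount-Σ² : ∀ v a b → gapSumCount v a b
                 ≡ Σ² a b (λ c d → δ ((a ∸ c) + (b ∸ d)) v * pathCount c d + gapSumCount v c d)
  gapSumCount-Σ² zero          a b = sym (Σ²-vanishing-gapSum 0 a b (λ _ → refl))
  gapSumCount-Σ² (suc zero)    a b = sym (Σ²-vanishing-gapSum 1 a b (λ _ → refl))
  gapSumCount-Σ² (suc (suc n)) a b = begin
    Σ (suc n) (λ i → stepCount (suc i) (suc (n ∸ i)) a b)
      ≡⟨ Σ-cong (suc n) (λ i _ → stepCount-Σ² i (n ∸ i) a b) ⟩
    Σ (suc n) (λ i → Σ² a b (term i))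
      ≡⟨ Σ-swap (suc n) a (λ i c → Σ b (term i c)) ⟩
    Σ a (λ c → Σ (suc n) (λ i → Σ b (term i c)))
      ≡⟨ Σ-cong a (λ c _ → Σ-swap (suc n) b (λ i → term i c)) ⟩
    Σ² a b (λ c d → Σ (suc n) (λ i → term i c d))
      ≡⟨ Σ²-cong a b (λ c d _ _ → trans (Σ-+ (suc n) (λ i → E i c d * pathCount c d) (λ i → stepCount (suc i) (suc (n ∸ i)) c d))
                                        (cong (_+ gapSumCount v c d) (Σ-*ʳ (suc n) (pathCount c d) (λ i → E i c d)))) ⟩
    Σ² a b (λ c d → Σ (suc n) (λ i → E i c d) * pathCount c d + gapSumCount v c d)
      ≡⟨ Σ²-cong a b (λ c d c<a d<b → cong (λ x → x * pathCount c d + gapSumCount v c d) (δ-gap v c<a d<b)) ⟨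
    Σ² a b (λ c d → δ ((a ∸ c) + (b ∸ d)) v * pathCount c d + gapSumCount v c d) ∎
    where
    v = suc (suc n)
    E : ℕ → ℕ → ℕ → ℕ
    E i c d = δ (a ∸ c) (suc i) * δ (b ∸ d) (suc (n ∸ i))
    term : ℕ → ℕ → ℕ → ℕ
    term i c d = E i c d * pathCount c d + stepCount (suc i) (suc (n ∸ i)) c d

  Additive : {A : Set} → (List A → ℕ) → Set
  Additive μ = ∀ xs ys → μ (xs ++ ys) ≡ μ xs + μ ys

  Σ-concat : ∀ {A : Set} (μ : List A → ℕ) → Additive μ →
             ∀ n (L : ℕ → List A) g → μ (concat (map L (applyUpTo g n))) ≡ Σ n (λ c → μ (L (g c)))
  Σ-concat μ additive zero    L g = sym (+-cancelˡ-≡ (μ []) 0 (μ []) (trans (+-identityʳ (μ [])) (additive [] [])))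
  Σ-concat μ additive (suc n) L g =
    trans (additive (L (g 0)) _) (cong (μ (L (g 0)) +_) (Σ-concat μ additive n L (g ∘ suc)))

  concat-map-∷ : ∀ (μ : List ℕ → ℕ) → Additive μ →
                 ∀ g xss → μ (concat (map (g ∷_) xss)) ≡ μ (g ∷ []) * length xss + μ (concat xss)
  concat-map-∷ μ additive g []         = sym (cong (_+ μ []) (*-zeroʳ (μ (g ∷ []))))
  concat-map-∷ μ additive g (xs ∷ xss) = begin
    μ ((g ∷ []) ++ (xs ++ concat (map (g ∷_) xss)))  ≡⟨ additive (g ∷ []) _ ⟩
    μg + μ (xs ++ concat (map (g ∷_) xss))            ≡⟨ cong (μg +_) (additive xs _) ⟩
    μg + (μ xs + μ (concat (map (g ∷_) xss)))         ≡⟨ cong (λ x → μg + (μ xs + x)) (concat-map-∷ μ additive g xss) ⟩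
    μg + (μ xs + (μg * length xss + μ (concat xss)))  ≡⟨ regroup μg (μ xs) (length xss) (μ (concat xss)) ⟩
    μg * suc (length xss) + (μ xs + μ (concat xss))   ≡⟨ cong (μg * suc (length xss) +_) (additive xs _) ⟨
    μg * suc (length xss) + μ (xs ++ concat xss)      ∎
    where
    μg = μ (g ∷ [])
    regroup : ∀ a b n c → a + (b + (a * n + c)) ≡ a * suc n + (b + c)
    regroup = solve-∀

  count : ℕ → List ℕ → ℕ
  count v xs = length (filter (_≟ v) xs)

  δ-refl : ∀ x → δ x x ≡ 1
  δ-refl zero    = refl
  δ-refl (suc x) = δ-refl x

  δ-≢ : ∀ {x y} → x ≢ y → δ x y ≡ 0
  δ-≢ {zero}  {zero}  x≢y = contradiction refl x≢y
  δ-≢ {zero}  {suc y} x≢y = refl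
  δ-≢ {suc x} {zero}  x≢y = refl
  δ-≢ {suc x} {suc y} x≢y = δ-≢ (x≢y ∘ cong suc)

  count-∷ : ∀ v x xs → count v (x ∷ xs) ≡ δ x v + count v xs
  count-∷ v x xs with x ≟ v
  ... | yes refl = trans (cong length (filter-accept (_≟ x) refl)) (cong (_+ count x xs) (sym (δ-refl x)))
  ... | no  x≢v  = trans (cong length (filter-reject (_≟ v) x≢v)) (cong (_+ count v xs) (sym (δ-≢ x≢v)))

  count-singleton : ∀ v x → count v (x ∷ []) ≡ δ x v
  count-singleton v x = trans (count-∷ v x []) (+-identityʳ (δ x v))

  count-additive : ∀ v → Additive (count v)
  count-additive v xs ys = trans (cong length (filter-++ (_≟ v) xs ys)) (length-++ (filter (_≟ v) xs))

  allGapSums : List (List Point) → List ℕ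
  allGapSums paths = concat (map gapSums paths)

  allGapSums-++ : ∀ xs ys → allGapSums (xs ++ ys) ≡ allGapSums xs ++ allGapSums ys
  allGapSums-++ []       ys = refl
  allGapSums-++ (p ∷ xs) ys = trans (cong (gapSums p ++_) (allGapSums-++ xs ys)) (sym (++-assoc (gapSums p) _ _))

  StartsAt : ℕ → ℕ → List Point → Set
  StartsAt a b p = ∃ λ rest → p ≡ (a , b) ∷ rest

  pathsF-start : ∀ f a b → All (StartsAt a b) (pathsF f a b)
  pathsF-start zero    a       b       = []
  pathsF-start (suc f) zero    zero    = (_ , refl) ∷ []
  pathsF-start (suc f) zero    (suc b) = []
  pathsF-start (suc f) (suc a) zero    = []
  pathsF-start (suc f) (suc a) (suc b) =
    concat⁺ (map⁺ (universal (λ c → concat⁺ (map⁺ (universal (λ d → map⁺ (universal (λ p → p , refl) (pathsF f c d)))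
                                                                (upTo (suc b)))))
                              (upTo (suc a))))

  allGapSums-prefix : ∀ {x y c d} paths → All (StartsAt c d) paths →
    allGapSums (map ((x , y) ∷_) paths) ≡ concat (map (((x ∸ c) + (y ∸ d)) ∷_) (map gapSums paths))
  allGapSums-prefix []          []                  = refl
  allGapSums-prefix (p ∷ paths) ((_ , refl) ∷ starts) = cong (gapSums (_ ∷ p) ++_) (allGapSums-prefix paths starts)

  Additive-allGapSums : ∀ (ν : List ℕ → ℕ) → Additive ν → Additive (ν ∘ allGapSums)
  Additive-allGapSums ν additive xs ys = trans (cong ν (allGapSums-++ xs ys)) (additive (allGapSums xs) _)

  allGapSums-prefix-measure : ∀ (ν : List ℕ → ℕ) → Additive ν → ∀ {x y c d} paths → All (StartsAt c d) paths →
    ν (allGapSums (map ((x , y) ∷_) paths)) ≡ ν (((x ∸ c) + (y ∸ d)) ∷ []) * length paths + ν (allGapSums paths)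
  allGapSums-prefix-measure ν additive {x} {y} {c} {d} paths starts = begin
    ν (allGapSums (map ((x , y) ∷_) paths))                     ≡⟨ cong ν (allGapSums-prefix paths starts) ⟩
    ν (concat (map (g ∷_) (map gapSums paths)))                 ≡⟨ concat-map-∷ ν additive g (map gapSums paths) ⟩
    ν (g ∷ []) * length (map gapSums paths) + ν (allGapSums paths)
      ≡⟨ cong (λ n → ν (g ∷ []) * n + ν (allGapSums paths)) (length-map gapSums paths) ⟩
    ν (g ∷ []) * length paths + ν (allGapSums paths)            ∎
    where
    g = (x ∸ c) + (y ∸ d)

  pathsF-Σ² : ∀ (μ : List (List Point) → ℕ) → Additive μ → ∀ f a b →
    μ (pathsF (suc f) (suc a) (suc b)) ≡ Σ² (suc a) (suc b) (λ c d → μ (map ((suc a , suc b) ∷_) (pathsF f c d)))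
  pathsF-Σ² μ additive f a b =
    trans (Σ-concat μ additive (suc a) (λ c → concat (map (prefixed c) (upTo (suc b)))) (λ c → c))
          (Σ-cong (suc a) (λ c _ → Σ-concat μ additive (suc b) (prefixed c) (λ d → d)))
    where
    prefixed : ℕ → ℕ → List (List Point)
    prefixed c d = map ((suc a , suc b) ∷_) (pathsF f c d)

  private
    fuel : ∀ {a f c} → suc a < suc f → c < suc a → c < f
    fuel (s≤s a<f) c<a = ≤-<-trans (≤-pred c<a) a<f

  length-pathsF : ∀ f a b → a < f → length (pathsF f a b) ≡ pathCount a b
  length-pathsF (suc f) zero    zero    _   = refl
  length-pathsF (suc f) zero    (suc b) _   = refl
  length-pathsF (suc f) (suc a) zero    _   = refl
  length-pathsF (suc f) (suc a) (suc b) a<f = begin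
    length (pathsF (suc f) (suc a) (suc b))
      ≡⟨ pathsF-Σ² length (λ xs _ → length-++ xs) f a b ⟩
    Σ² (suc a) (suc b) (λ c d → length (map ((suc a , suc b) ∷_) (pathsF f c d)))
      ≡⟨ Σ²-cong (suc a) (suc b) (λ c d c<a _ → trans (length-map ((suc a , suc b) ∷_) (pathsF f c d))
                                                       (length-pathsF f c d (fuel a<f c<a))) ⟩
    Σ² (suc a) (suc b) pathCount
      ≡⟨ pathCount-Σ² a b ⟨
    pathCount (suc a) (suc b) ∎

  count-pathsF : ∀ f a b → a < f → ∀ v → count v (allGapSums (pathsF f a b)) ≡ gapSumCount v a b
  count-pathsF (suc f) zero    zero    _   v = sym (gapSumCount-Σ² v 0 0)
  count-pathsF (suc f) zero    (suc b) _   v = sym (gapSumCount-Σ² v 0 (suc b))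
  count-pathsF (suc f) (suc a) zero    _   v = sym (trans (gapSumCount-Σ² v (suc a) 0) (Σ-zero (suc a)))
  count-pathsF (suc f) (suc a) (suc b) a<f v = begin
    count v (allGapSums (pathsF (suc f) (suc a) (suc b)))
      ≡⟨ pathsF-Σ² (count v ∘ allGapSums) (Additive-allGapSums (count v) (count-additive v)) f a b ⟩
    Σ² (suc a) (suc b) (λ c d → count v (allGapSums (map ((suc a , suc b) ∷_) (pathsF f c d))))
      ≡⟨ Σ²-cong (suc a) (suc b) step ⟩
    Σ² (suc a) (suc b) (λ c d → δ ((suc a ∸ c) + (suc b ∸ d)) v * pathCount c d + gapSumCount v c d)
      ≡⟨ gapSumCount-Σ² v (suc a) (suc b) ⟨
    gapSumCount v (suc a) (suc b) ∎
    where
    step : ∀ c d → c < suc a → d < suc b → count v (allGapSums (map ((suc a , suc b) ∷_) (pathsF f c d)))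
         ≡ δ ((suc a ∸ c) + (suc b ∸ d)) v * pathCount c d + gapSumCount v c d
    step c d c<a _ = begin
      count v (allGapSums (map ((suc a , suc b) ∷_) (pathsF f c d)))
        ≡⟨ allGapSums-prefix-measure (count v) (count-additive v) (pathsF f c d) (pathsF-start f c d) ⟩
      count v (g ∷ []) * length (pathsF f c d) + count v (allGapSums (pathsF f c d))
        ≡⟨ cong₂ _+_ (cong₂ _*_ (count-singleton v g) (length-pathsF f c d c<f)) (count-pathsF f c d c<f v) ⟩
      δ g v * pathCount c d + gapSumCount v c d ∎
      where
      g = (suc a ∸ c) + (suc b ∸ d)
      c<f = fuel a<f c<a

  length-allGapSums-pathsF : ∀ f a b → a < f →
                             length (allGapSums (pathsF f a b)) + length (pathsF f a b) ≡ pointCount a b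
  length-allGapSums-pathsF (suc f) zero    zero    _   = refl
  length-allGapSums-pathsF (suc f) zero    (suc b) _   = refl
  length-allGapSums-pathsF (suc f) (suc a) zero    _   = refl
  length-allGapSums-pathsF (suc f) (suc a) (suc b) a<f = begin
    length (allGapSums (pathsF (suc f) (suc a) (suc b))) + length (pathsF (suc f) (suc a) (suc b))
      ≡⟨ cong₂ _+_ (pathsF-Σ² (length ∘ allGapSums) (Additive-allGapSums length (λ xs _ → length-++ xs)) f a b)
                   (length-pathsF (suc f) (suc a) (suc b) a<f) ⟩
    Σ² (suc a) (suc b) (λ c d → length (allGapSums (map ((suc a , suc b) ∷_) (pathsF f c d)))) + pathCount (suc a) (suc b)
      ≡⟨ cong (_+ pathCount (suc a) (suc b)) (Σ²-cong (suc a) (suc b) step) ⟩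
    Σ² (suc a) (suc b) pointCount + pathCount (suc a) (suc b)
      ≡⟨ +-comm _ (pathCount (suc a) (suc b)) ⟩
    pathCount (suc a) (suc b) + Σ² (suc a) (suc b) pointCount
      ≡⟨ pointCount-Σ² (suc a) (suc b) ⟨
    pointCount (suc a) (suc b) ∎
    where
    step : ∀ c d → c < suc a → d < suc b →
           length (allGapSums (map ((suc a , suc b) ∷_) (pathsF f c d))) ≡ pointCount c d
    step c d c<a _ = begin
      length (allGapSums (map ((suc a , suc b) ∷_) (pathsF f c d)))
        ≡⟨ allGapSums-prefix-measure length (λ xs _ → length-++ xs) (pathsF f c d) (pathsF-start f c d) ⟩
      1 * length (pathsF f c d) + length (allGapSums (pathsF f c d))
        ≡⟨ trans (cong (_+ length (allGapSums (pathsF f c d))) (*-identityˡ (length (pathsF f c d))))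
                 (+-comm (length (pathsF f c d)) _) ⟩
      length (allGapSums (pathsF f c d)) + length (pathsF f c d)
        ≡⟨ length-allGapSums-pathsF f c d (fuel a<f c<a) ⟩
      pointCount c d ∎

  countGap≡gapSumCount : ∀ n v → countGap n v ≡ gapSumCount v (suc n) (suc n)
  countGap≡gapSumCount n v = count-pathsF (suc (suc n)) (suc n) (suc n) ≤-refl v

  length-gapSumMultiset : ∀ n → length (gapSumMultiset n) + binom n n ≡ pointCount (suc n) (suc n)
  length-gapSumMultiset n =
    trans (cong (length (gapSumMultiset n) +_) (sym (length-pathsF (suc (suc n)) (suc n) (suc n) ≤-refl)))
          (length-allGapSums-pathsF (suc (suc n)) (suc n) (suc n) ≤-refl)

module Asymptotics where

  open import Data.Nat using (ℕ; zero; suc; _+_; _*_; _∸_; _^_; _≤_; _<_; z≤n; s≤s; NonZero; >-nonZero)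
  open import Data.Product using (_×_; _,_)
  open import Data.Nat.Properties
  open import Data.Nat.Tactic.RingSolver using (solve-∀)
  open import Relation.Binary.PropositionalEquality
  open Counting

  binom-sym : ∀ i j → binom i j ≡ binom j i
  binom-sym zero    j       = sym (binom-n0 j)
  binom-sym (suc i) zero    = refl
  binom-sym (suc i) (suc j) =
    trans (cong₂ _+_ (binom-sym i (suc j)) (binom-sym (suc i) j)) (+-comm (binom (suc j) i) (binom j (suc i)))

  binom-pos : ∀ i j → 1 ≤ binom i j
  binom-pos zero    j       = s≤s z≤n
  binom-pos (suc i) zero    = s≤s z≤n
  binom-pos (suc i) (suc j) = ≤-trans (binom-pos i (suc j)) (m≤m+n _ _)

  binom-sucˡ : ∀ i j → binom (suc i) j * suc i ≡ binom i j * suc (i + j)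
  binom-sucˡ i       zero    = trans (*-identityˡ (suc i))
                                     (sym (trans (cong₂ _*_ (binom-n0 i) (cong suc (+-identityʳ i))) (*-identityˡ (suc i))))
  binom-sucˡ zero    (suc j) = trans (*-identityʳ _) (trans (cong suc (binom-1n j)) (sym (*-identityˡ _)))
  binom-sucˡ (suc i) (suc j) = begin
    (p + q) * suc (suc i)                               ≡⟨ split p q i ⟩
    p * suc i + p + q * suc (suc i)                     ≡⟨ cong₂ (λ u w → u + p + w) (binom-sucˡ i (suc j)) (binom-sucˡ (suc i) j) ⟩
    x * suc (i + suc j) + (x + y) + y * suc (suc i + j) ≡⟨ merge x y i j ⟩
    (x + y) * suc (suc i + suc j)                       ∎
    where
    open ≡-Reasoning
    p = binom (suc i) (suc j)
    q = binom (suc (suc i)) j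
    x = binom i (suc j)
    y = binom (suc i) j
    split : ∀ p q i → (p + q) * suc (suc i) ≡ p * suc i + p + q * suc (suc i)
    split = solve-∀
    merge : ∀ x y i j → x * suc (i + suc j) + (x + y) + y * suc (suc i + j) ≡ (x + y) * suc (suc i + suc j)
    merge = solve-∀

  binom-sucʳ : ∀ i j → binom i (suc j) * suc j ≡ binom i j * suc (i + j)
  binom-sucʳ i j = begin
    binom i (suc j) * suc j  ≡⟨ cong (_* suc j) (binom-sym i (suc j)) ⟩
    binom (suc j) i * suc j  ≡⟨ binom-sucˡ j i ⟩
    binom j i * suc (j + i)  ≡⟨ cong₂ (λ u w → u * suc w) (binom-sym j i) (+-comm j i) ⟩
    binom i j * suc (i + j)  ∎
    where open ≡-Reasoning

  *-ratio-≤ : ∀ a b {m n p q} → a * m ≡ b * n → p ≤ m → n ≤ q → a * p ≤ b * q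
  *-ratio-≤ a b {m} {n} {p} {q} am≡bn p≤m n≤q = begin
    a * p  ≤⟨ *-monoʳ-≤ a p≤m ⟩
    a * m  ≡⟨ am≡bn ⟩
    b * n  ≤⟨ *-monoʳ-≤ b n≤q ⟩
    b * q  ∎
    where open ≤-Reasoning

  *-ratio-trans : ∀ a b c {p q r s} → a * p ≤ b * q → b * r ≤ c * s → a * (p * r) ≤ c * (q * s)
  *-ratio-trans a b c {p} {q} {r} {s} ap≤bq br≤cs = begin
    a * (p * r)  ≡⟨ *-assoc a p r ⟨
    a * p * r    ≤⟨ *-monoˡ-≤ r ap≤bq ⟩
    b * q * r    ≡⟨ swap b q r ⟩
    q * (b * r)  ≤⟨ *-monoʳ-≤ q br≤cs ⟩
    q * (c * s)  ≡⟨ trans (sym (*-assoc q c s)) (swap q c s) ⟩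
    c * (q * s)  ∎
    where
    open ≤-Reasoning
    swap : ∀ x y z → x * y * z ≡ y * (x * z)
    swap = solve-∀

  -- A unit step from (i , j) multiplies binom by (i + j + 1) / (i + 1) resp. (i + j + 1) / (j + 1);
  -- the two chains bound these factors from above by U / L and from below by L / U.
  binom-chain-lower : ∀ L U g₁ g₂ x y → L ≤ suc x → L ≤ suc y → g₁ + x + (g₂ + y) ≤ U →
                      binom (g₁ + x) (g₂ + y) * L ^ (g₁ + g₂) ≤ binom x y * U ^ (g₁ + g₂)
  binom-chain-lower L U zero    zero    x y L≤x L≤y ≤U = ≤-refl
  binom-chain-lower L U zero    (suc g) x y L≤x L≤y ≤U =
    *-ratio-trans (binom x (suc (g + y))) (binom x (g + y)) (binom x y) step
      (binom-chain-lower L U zero g x y L≤x L≤y (≤-trans (+-monoʳ-≤ x (n≤1+n (g + y))) ≤U))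
    where
    step : binom x (suc (g + y)) * L ≤ binom x (g + y) * U
    step = *-ratio-≤ (binom x (suc (g + y))) (binom x (g + y)) (binom-sucʳ x (g + y))
             (≤-trans L≤y (s≤s (m≤n+m y g))) (≤-trans (≤-reflexive (sym (+-suc x (g + y)))) ≤U)
  binom-chain-lower L U (suc g) g₂      x y L≤x L≤y ≤U =
    *-ratio-trans (binom (suc (g + x)) (g₂ + y)) (binom (g + x) (g₂ + y)) (binom x y) step
      (binom-chain-lower L U g g₂ x y L≤x L≤y (≤-trans (n≤1+n _) ≤U))
    where
    step : binom (suc (g + x)) (g₂ + y) * L ≤ binom (g + x) (g₂ + y) * U
    step = *-ratio-≤ (binom (suc (g + x)) (g₂ + y)) (binom (g + x) (g₂ + y)) (binom-sucˡ (g + x) (g₂ + y))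
             (≤-trans L≤x (s≤s (m≤n+m x g))) ≤U

  binom-chain-upper : ∀ L U g₁ g₂ x y → g₁ + x ≤ U → g₂ + y ≤ U → L ≤ suc (x + y) →
                      binom x y * L ^ (g₁ + g₂) ≤ binom (g₁ + x) (g₂ + y) * U ^ (g₁ + g₂)
  binom-chain-upper L U zero    zero    x y x≤U y≤U L≤ = ≤-refl
  binom-chain-upper L U zero    (suc g) x y x≤U y≤U L≤ =
    subst₂ (λ p q → binom x y * p ≤ binom x (suc (g + y)) * q) (*-comm (L ^ g) L) (*-comm (U ^ g) U)
      (*-ratio-trans (binom x y) (binom x (g + y)) (binom x (suc (g + y)))
        (binom-chain-upper L U zero g x y x≤U (≤-trans (n≤1+n (g + y)) y≤U) L≤) step)
    where
    step : binom x (g + y) * L ≤ binom x (suc (g + y)) * U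
    step = *-ratio-≤ (binom x (g + y)) (binom x (suc (g + y))) (sym (binom-sucʳ x (g + y)))
             (≤-trans L≤ (s≤s (+-monoʳ-≤ x (m≤n+m y g)))) y≤U
  binom-chain-upper L U (suc g) g₂      x y x≤U y≤U L≤ =
    subst₂ (λ p q → binom x y * p ≤ binom (suc (g + x)) (g₂ + y) * q) (*-comm (L ^ (g + g₂)) L) (*-comm (U ^ (g + g₂)) U)
      (*-ratio-trans (binom x y) (binom (g + x) (g₂ + y)) (binom (suc (g + x)) (g₂ + y))
        (binom-chain-upper L U g g₂ x y (≤-trans (n≤1+n (g + x)) x≤U) y≤U L≤) step)
    where
    step : binom (g + x) (g₂ + y) * L ≤ binom (suc (g + x)) (g₂ + y) * U
    step = *-ratio-≤ (binom (g + x) (g₂ + y)) (binom (suc (g + x)) (g₂ + y)) (sym (binom-sucˡ (g + x) (g₂ + y)))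
             (≤-trans L≤ (s≤s (+-mono-≤ (m≤n+m x g) (m≤n+m y g₂)))) x≤U

  ^-distribʳ-* : ∀ a b n → (a * b) ^ n ≡ a ^ n * b ^ n
  ^-distribʳ-* a b zero    = refl
  ^-distribʳ-* a b (suc n) = trans (cong (a * b *_) (^-distribʳ-* a b n)) (regroup a b (a ^ n) (b ^ n))
    where
    regroup : ∀ a b x y → a * b * (x * y) ≡ a * x * (b * y)
    regroup = solve-∀

  ^-bernoulli : ∀ y d k → (y + d) ^ suc k ≤ y ^ suc k + suc k * d * (y + d) ^ k
  ^-bernoulli y d zero    = ≤-reflexive (identity y d)
    where
    identity : ∀ y d → (y + d) * 1 ≡ y * 1 + 1 * d * 1
    identity = solve-∀
  ^-bernoulli y d (suc k) = begin
    (y + d) * (y + d) ^ suc k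
      ≤⟨ *-monoʳ-≤ (y + d) (^-bernoulli y d k) ⟩
    (y + d) * (y ^ suc k + suc k * d * (y + d) ^ k)
      ≡⟨ expand y d (y ^ suc k) k ((y + d) ^ k) ⟩
    y * y ^ suc k + (d * y ^ suc k + suc k * d * ((y + d) * (y + d) ^ k))
      ≤⟨ +-monoʳ-≤ (y * y ^ suc k) (+-monoˡ-≤ _ (*-monoʳ-≤ d (^-monoˡ-≤ (suc k) (m≤m+n y d)))) ⟩
    y * y ^ suc k + (d * (y + d) ^ suc k + suc k * d * ((y + d) * (y + d) ^ k))
      ≡⟨ collect (y * y ^ suc k) d ((y + d) ^ suc k) k ⟩
    y * y ^ suc k + suc (suc k) * d * (y + d) ^ suc k ∎
    where
    open ≤-Reasoning
    expand : ∀ y d Y k W → (y + d) * (Y + suc k * d * W) ≡ y * Y + (d * Y + suc k * d * ((y + d) * W))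
    expand = solve-∀
    collect : ∀ a d W k → a + (d * W + suc k * d * W) ≡ a + suc (suc k) * d * W
    collect = solve-∀

  binom-suc-suc : ∀ i j → binom (suc i) (suc j) * (suc i * suc j) ≡ binom i j * (suc (i + j) * suc (suc (i + j)))
  binom-suc-suc i j = begin
    binom (suc i) (suc j) * (suc i * suc j)           ≡⟨ *-assoc (binom (suc i) (suc j)) (suc i) (suc j) ⟨
    binom (suc i) (suc j) * suc i * suc j             ≡⟨ cong (_* suc j) (binom-sucˡ i (suc j)) ⟩
    binom i (suc j) * suc (i + suc j) * suc j         ≡⟨ swap (binom i (suc j)) (suc (i + suc j)) (suc j) ⟩
    binom i (suc j) * suc j * suc (i + suc j)         ≡⟨ cong₂ (λ u w → u * suc w) (binom-sucʳ i j) (+-suc i j) ⟩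
    binom i j * suc (i + j) * suc (suc (i + j))       ≡⟨ *-assoc (binom i j) _ _ ⟩
    binom i j * (suc (i + j) * suc (suc (i + j)))     ∎
    where
    open ≡-Reasoning
    swap : ∀ a b c → a * b * c ≡ a * c * b
    swap = solve-∀

  binom-diagonal : ∀ m → binom (suc m) (suc m) * suc m ≡ 2 * suc (m + m) * binom m m
  binom-diagonal m = *-cancelʳ-≡ _ _ (suc m) (begin
    binom (suc m) (suc m) * suc m * suc m                   ≡⟨ *-assoc (binom (suc m) (suc m)) (suc m) (suc m) ⟩
    binom (suc m) (suc m) * (suc m * suc m)                 ≡⟨ binom-suc-suc m m ⟩
    binom m m * (suc (m + m) * suc (suc (m + m)))           ≡⟨ regroup (binom m m) m ⟩
    2 * suc (m + m) * binom m m * suc m                     ∎)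
    where
    open ≡-Reasoning
    regroup : ∀ r m → r * (suc (m + m) * suc (suc (m + m))) ≡ 2 * suc (m + m) * r * suc m
    regroup = solve-∀

  sum-square-≤ : ∀ p q → p ≤ 2 * q → q ≤ 2 * p → (p + q) * (p + q) ≤ 8 * (p * q)
  sum-square-≤ p q p≤2q q≤2p = begin
    (p + q) * (p + q)               ≡⟨ expand p q ⟩
    p * p + q * q + 2 * (p * q)     ≤⟨ +-monoˡ-≤ (2 * (p * q)) (+-mono-≤ (*-monoʳ-≤ p p≤2q) (*-monoʳ-≤ q q≤2p)) ⟩
    p * (2 * q) + q * (2 * p) + 2 * (p * q) ≡⟨ collect p q ⟩
    6 * (p * q)                     ≤⟨ *-monoˡ-≤ (p * q) (m≤m+n 6 2) ⟩
    8 * (p * q)                     ∎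
    where
    open ≤-Reasoning
    expand : ∀ p q → (p + q) * (p + q) ≡ p * p + q * q + 2 * (p * q)
    expand = solve-∀
    collect : ∀ p q → p * (2 * q) + q * (2 * p) + 2 * (p * q) ≡ 6 * (p * q)
    collect = solve-∀

  shift-offset : ∀ g h z → shift g h (g + z) ≡ h z
  shift-offset zero    h z = refl
  shift-offset (suc g) h z = shift-offset g h z

  -- In ratio form: W ≥ Up SZ ≥ Up Q (1 − vD / U) ≥ Q P (M − K) / N.
  combine-lower : ∀ Up U M K vD P Q SZ W N → .{{_ : NonZero U}} →
    Up * SZ ≤ W → Q * U ≤ SZ * U + Q * vD → P * M * U + Up * N * vD ≤ Up * N * U + P * K * U →
    Q * P * M ≤ W * N + Q * P * K
  combine-lower Up U M K vD P Q SZ W N Up*SZ≤W QU≤ poly = *-cancelʳ-≤ _ _ U (+-cancelʳ-≤ c _ _ (begin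
    Q * P * M * U + c                            ≡⟨ factor Q P M U Up N vD ⟩
    Q * (P * M * U + Up * N * vD)                ≤⟨ *-monoʳ-≤ Q poly ⟩
    Q * (Up * N * U + P * K * U)                 ≡⟨ regroup Q Up N U P K ⟩
    Up * N * (Q * U) + Q * P * K * U             ≤⟨ +-monoˡ-≤ (Q * P * K * U) (*-monoʳ-≤ (Up * N) QU≤) ⟩
    Up * N * (SZ * U + Q * vD) + Q * P * K * U   ≡⟨ expand Up N SZ U Q vD P K ⟩
    Up * SZ * N * U + Q * P * K * U + c          ≤⟨ +-monoˡ-≤ c (+-monoˡ-≤ (Q * P * K * U) (*-monoˡ-≤ U (*-monoˡ-≤ N Up*SZ≤W))) ⟩
    W * N * U + Q * P * K * U + c                ≡⟨ cong (_+ c) (*-distribʳ-+ U (W * N) (Q * P * K)) ⟨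
    (W * N + Q * P * K) * U + c                  ∎))
    where
    open ≤-Reasoning
    c = Q * (Up * N * vD)
    factor : ∀ Q P M U Up N vD → Q * P * M * U + Q * (Up * N * vD) ≡ Q * (P * M * U + Up * N * vD)
    factor = solve-∀
    regroup : ∀ Q Up N U P K → Q * (Up * N * U + P * K * U) ≡ Up * N * (Q * U) + Q * P * K * U
    regroup = solve-∀
    expand : ∀ Up N SZ U Q vD P K → Up * N * (SZ * U + Q * vD) + Q * P * K * U ≡ Up * SZ * N * U + Q * P * K * U + Q * (Up * N * vD)
    expand = solve-∀

  -- In ratio form: W ≤ Up SZ ≤ Up Q U / (U − vk) ≤ Q P L / N.
  combine-upper : ∀ Up U N L vk P Q SZ W → .{{_ : NonZero U}} →
    W ≤ Up * SZ → SZ * U ≤ Q * U + SZ * vk → Up * N * U + P * L * vk ≤ P * L * U →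
    W * N ≤ Q * P * L
  combine-upper Up U N L vk P Q SZ W W≤Up*SZ SZU≤ poly = begin
    W * N              ≤⟨ *-monoˡ-≤ N W≤Up*SZ ⟩
    Up * SZ * N        ≤⟨ *-cancelʳ-≤ _ _ U (+-cancelʳ-≤ c _ _ (begin
      Up * SZ * N * U + c          ≡⟨ factor Up SZ N U P L vk ⟩
      SZ * (Up * N * U + P * L * vk) ≤⟨ *-monoʳ-≤ SZ poly ⟩
      SZ * (P * L * U)             ≡⟨ regroup SZ P L U ⟩
      P * L * (SZ * U)             ≤⟨ *-monoʳ-≤ (P * L) SZU≤ ⟩
      P * L * (Q * U + SZ * vk)    ≡⟨ expand P L Q U SZ vk ⟩
      Q * P * L * U + c            ∎)) ⟩
    Q * P * L          ∎
    where
    open ≤-Reasoning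
    c = SZ * (P * L * vk)
    factor : ∀ Up SZ N U P L vk → Up * SZ * N * U + SZ * (P * L * vk) ≡ SZ * (Up * N * U + P * L * vk)
    factor = solve-∀
    regroup : ∀ SZ P L U → SZ * (P * L * U) ≡ P * L * (SZ * U)
    regroup = solve-∀
    expand : ∀ P L Q U SZ vk → P * L * (Q * U + SZ * vk) ≡ Q * P * L * U + SZ * (P * L * vk)
    expand = solve-∀

  multiset-length : ∀ m T → T + binom (suc m) (suc m) ≡ pointCount (suc (suc m)) (suc (suc m)) →
                    T ≡ binom (suc m) (suc m) + suc (m + m) * binom m m
  multiset-length m T T+≡ =
    +-cancelʳ-≡ (binom (suc m) (suc m)) _ _ (trans T+≡ (swap (binom (suc m) (suc m)) (suc (m + m) * binom m m)))
    where
    swap : ∀ a b → 2 * a + b ≡ a + b + a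
    swap = solve-∀

  multiset-size : ∀ m T → T + binom (suc m) (suc m) ≡ pointCount (suc (suc m)) (suc (suc m)) →
                  T * suc m ≡ suc (2 * m) * (m + 3) * binom m m
  multiset-size m T T+≡ = begin
    T * suc m                                                   ≡⟨ cong (_* suc m) (multiset-length m T T+≡) ⟩
    (binom (suc m) (suc m) + suc (m + m) * binom m m) * suc m   ≡⟨ *-distribʳ-+ (suc m) (binom (suc m) (suc m)) _ ⟩
    binom (suc m) (suc m) * suc m + suc (m + m) * binom m m * suc m
      ≡⟨ cong (_+ suc (m + m) * binom m m * suc m) (binom-diagonal m) ⟩
    2 * suc (m + m) * binom m m + suc (m + m) * binom m m * suc m ≡⟨ collect m (binom m m) ⟩
    suc (2 * m) * (m + 3) * binom m m                           ∎
    where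
    open ≡-Reasoning
    collect : ∀ m r → 2 * suc (m + m) * r + suc (m + m) * r * suc m ≡ suc (2 * m) * (m + 3) * r
    collect = solve-∀

  module Estimate (k t : ℕ) where

    v M U Up R : ℕ
    v  = suc (suc k)
    M  = suc (suc (k + t))
    U  = 2 * M
    Up = suc (suc (suc (k + t + t)))
    R  = binom M M

    -- The gap vector (i + 1 , k + 1 − i) on paths from (M + 2 , M + 2); its gap sum is v.
    module GapVector (i : ℕ) (i≤k : i ≤ k) where
      private
        j = k ∸ i
        i+j≡k : i + j ≡ k
        i+j≡k = m+[n∸m]≡n i≤k

      x y X : ℕ
      x = suc (j + t)
      y = suc (i + t)
      X = binom x y

      g₁+x≡M : suc i + x ≡ M
      g₁+x≡M = trans (regroup i j t) (cong (λ s → suc (suc (s + t))) i+j≡k)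
        where
        regroup : ∀ i j t → suc i + suc (j + t) ≡ suc (suc (i + j + t))
        regroup = solve-∀

      g₂+y≡M : suc j + y ≡ M
      g₂+y≡M = trans (regroup i j t) (cong (λ s → suc (suc (s + t))) i+j≡k)
        where
        regroup : ∀ i j t → suc j + suc (i + t) ≡ suc (suc (i + j + t))
        regroup = solve-∀

      g₁+g₂≡v : suc i + suc j ≡ v
      g₁+g₂≡v = cong suc (trans (+-suc i j) (cong suc i+j≡k))

      x+y+1≡Up : suc (x + y) ≡ Up
      x+y+1≡Up = trans (regroup i j t) (cong (λ s → suc (suc (suc (s + t + t)))) i+j≡k)
        where
        regroup : ∀ i j t → suc (suc (j + t) + suc (i + t)) ≡ suc (suc (suc (i + j + t + t)))
        regroup = solve-∀

      binom-ratio-lower : R * U ≤ 2 ^ v * X * U + R * (v * (2 * suc k))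
      binom-ratio-lower = *-cancelʳ-≤ _ _ (U ^ suc k) {{m^n≢0 U (suc k)}} (begin
        R * U * U ^ suc k                                ≡⟨ *-assoc R U (U ^ suc k) ⟩
        R * U ^ v                                        ≡⟨ cong (λ z → R * z ^ v) 2L+D≡U ⟨
        R * (2 * L + D) ^ v                              ≤⟨ *-monoʳ-≤ R (^-bernoulli (2 * L) D (suc k)) ⟩
        R * ((2 * L) ^ v + v * D * (2 * L + D) ^ suc k)  ≡⟨ cong₂ (λ z w → R * (z + v * D * w ^ suc k)) (^-distribʳ-* 2 L v) 2L+D≡U ⟩
        R * (2 ^ v * L ^ v + v * D * U ^ suc k)          ≡⟨ expand R (2 ^ v) (L ^ v) (v * D) (U ^ suc k) ⟩
        2 ^ v * (R * L ^ v) + R * (v * D) * U ^ suc k    ≤⟨ +-monoˡ-≤ (R * (v * D) * U ^ suc k) (*-monoʳ-≤ (2 ^ v) R*L^v≤X*U^v) ⟩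
        2 ^ v * (X * U ^ v) + R * (v * D) * U ^ suc k    ≡⟨ collect (2 ^ v) X U (U ^ suc k) (R * (v * D)) ⟩
        (2 ^ v * X * U + R * (v * D)) * U ^ suc k        ∎)
        where
        open ≤-Reasoning
        L = suc t
        D = 2 * suc k
        2L+D≡U : 2 * L + D ≡ U
        2L+D≡U = regroup k t
          where
          regroup : ∀ k t → 2 * suc t + 2 * suc k ≡ 2 * suc (suc (k + t))
          regroup = solve-∀
        R*L^v≤X*U^v : R * L ^ v ≤ X * U ^ v
        R*L^v≤X*U^v = subst₂ _≤_ (cong₂ _*_ (cong₂ binom g₁+x≡M g₂+y≡M) (cong (L ^_) g₁+g₂≡v))
                                 (cong (λ z → X * U ^ z) g₁+g₂≡v)
          (binom-chain-lower L U (suc i) (suc j) x y (s≤s (≤-trans (m≤n+m t j) (n≤1+n _))) (s≤s (≤-trans (m≤n+m t i) (n≤1+n _)))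
            (≤-reflexive (trans (cong₂ _+_ g₁+x≡M g₂+y≡M) (cong (M +_) (sym (+-identityʳ M))))))
        expand : ∀ R p q w u → R * (p * q + w * u) ≡ p * (R * q) + R * w * u
        expand = solve-∀
        collect : ∀ p X U W r → p * (X * (U * W)) + r * W ≡ (p * X * U + r) * W
        collect = solve-∀

      binom-ratio-upper : 2 ^ v * X * U ≤ R * U + 2 ^ v * X * (v * suc k)
      binom-ratio-upper = *-cancelʳ-≤ _ _ (U ^ suc k) {{m^n≢0 U (suc k)}} (begin
        2 ^ v * X * U * U ^ suc k                           ≡⟨ *-assoc (2 ^ v * X) U (U ^ suc k) ⟩
        2 ^ v * X * U ^ v                                   ≡⟨ cong (λ z → 2 ^ v * X * z ^ v) Up+D≡U ⟨
        2 ^ v * X * (Up + D) ^ v                            ≤⟨ *-monoʳ-≤ (2 ^ v * X) (^-bernoulli Up D (suc k)) ⟩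
        2 ^ v * X * (Up ^ v + v * D * (Up + D) ^ suc k)     ≡⟨ cong (λ z → 2 ^ v * X * (Up ^ v + v * D * z ^ suc k)) Up+D≡U ⟩
        2 ^ v * X * (Up ^ v + v * D * U ^ suc k)            ≡⟨ expand (2 ^ v) X (Up ^ v) (v * D) (U ^ suc k) ⟩
        2 ^ v * (X * Up ^ v) + 2 ^ v * X * (v * D) * U ^ suc k
          ≤⟨ +-monoˡ-≤ (2 ^ v * X * (v * D) * U ^ suc k) (*-monoʳ-≤ (2 ^ v) X*Up^v≤R*M^v) ⟩
        2 ^ v * (R * M ^ v) + 2 ^ v * X * (v * D) * U ^ suc k
          ≡⟨ cong (_+ 2 ^ v * X * (v * D) * U ^ suc k) (trans (swap (2 ^ v) R (M ^ v)) (cong (R *_) (sym (^-distribʳ-* 2 M v)))) ⟩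
        R * U ^ v + 2 ^ v * X * (v * D) * U ^ suc k         ≡⟨ collect R U (U ^ suc k) (2 ^ v * X * (v * D)) ⟩
        (R * U + 2 ^ v * X * (v * D)) * U ^ suc k           ∎)
        where
        open ≤-Reasoning
        D = suc k
        Up+D≡U : Up + D ≡ U
        Up+D≡U = regroup k t
          where
          regroup : ∀ k t → suc (suc (suc (k + t + t))) + suc k ≡ 2 * suc (suc (k + t))
          regroup = solve-∀
        X*Up^v≤R*M^v : X * Up ^ v ≤ R * M ^ v
        X*Up^v≤R*M^v = subst₂ _≤_ (cong (λ z → X * Up ^ z) g₁+g₂≡v)
                                  (cong₂ _*_ (cong₂ binom g₁+x≡M g₂+y≡M) (cong (M ^_) g₁+g₂≡v))
          (binom-chain-upper Up M (suc i) (suc j) x y (≤-reflexive g₁+x≡M) (≤-reflexive g₂+y≡M) (≤-reflexive (sym x+y+1≡Up)))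
        expand : ∀ p X q w u → p * X * (q + w * u) ≡ p * (X * q) + p * X * w * u
        expand = solve-∀
        swap : ∀ p R q → p * (R * q) ≡ R * (p * q)
        swap = solve-∀
        collect : ∀ R U W r → R * (U * W) + r * W ≡ (R * U + r) * W
        collect = solve-∀

      stepCount≡pointCount : stepCount (suc i) (suc j) (suc (suc M)) (suc (suc M)) ≡ pointCount (suc (suc x)) (suc (suc y))
      stepCount≡pointCount = begin
        shift (suc i) (λ c → shift (suc j) (pointCount c) (suc (suc M))) (suc (suc M))
          ≡⟨ cong₂ (λ p q → shift (suc i) (λ c → shift (suc j) (pointCount c) q) p) (split g₁+x≡M) (split g₂+y≡M) ⟩
        shift (suc i) (λ c → shift (suc j) (pointCount c) (suc j + suc (suc y))) (suc i + suc (suc x))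
          ≡⟨ shift-offset (suc i) _ (suc (suc x)) ⟩
        shift (suc j) (pointCount (suc (suc x))) (suc j + suc (suc y))
          ≡⟨ shift-offset (suc j) _ (suc (suc y)) ⟩
        pointCount (suc (suc x)) (suc (suc y)) ∎
        where
        open ≡-Reasoning
        split : ∀ {g z} → suc g + z ≡ M → suc (suc M) ≡ suc g + suc (suc z)
        split {g} {z} eq = sym (trans (+-suc (suc g) (suc z)) (cong suc (trans (+-suc (suc g) z) (cong suc eq))))

      steps-lower : Up * X ≤ stepCount (suc i) (suc j) (suc (suc M)) (suc (suc M))
      steps-lower = begin
        Up * X                                    ≡⟨ cong (_* X) x+y+1≡Up ⟨
        suc (x + y) * X                           ≤⟨ m≤n+m _ (2 * binom (suc x) (suc y)) ⟩
        pointCount (suc (suc x)) (suc (suc y))    ≡⟨ stepCount≡pointCount ⟨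
        stepCount (suc i) (suc j) (suc (suc M)) (suc (suc M)) ∎
        where open ≤-Reasoning

      steps-upper : k ≤ t → stepCount (suc i) (suc j) (suc (suc M)) (suc (suc M)) ≤ (Up + 16) * X
      steps-upper k≤t = begin
        stepCount (suc i) (suc j) (suc (suc M)) (suc (suc M)) ≡⟨ stepCount≡pointCount ⟩
        2 * binom (suc x) (suc y) + suc (x + y) * X          ≤⟨ +-monoˡ-≤ (suc (x + y) * X) (*-monoʳ-≤ 2 binom-suc-suc≤8) ⟩
        2 * (8 * X) + suc (x + y) * X                        ≡⟨ collect (suc (x + y)) X ⟩
        (suc (x + y) + 16) * X                               ≡⟨ cong (λ z → (z + 16) * X) x+y+1≡Up ⟩
        (Up + 16) * X                                        ∎
        where
        open ≤-Reasoning
        collect : ∀ u X → 2 * (8 * X) + u * X ≡ (u + 16) * X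
        collect = solve-∀
        balanced : ∀ {a b} → a ≤ t → suc (suc (a + t)) ≤ 2 * suc (suc (b + t))
        balanced {a} {b} a≤t = ≤-trans (s≤s (s≤s (+-monoˡ-≤ t a≤t)))
          (≤-trans (m≤m+n _ (2 * b + 2)) (≤-reflexive (regroup b t)))
          where
          regroup : ∀ b t → suc (suc (t + t)) + (2 * b + 2) ≡ 2 * suc (suc (b + t))
          regroup = solve-∀
        binom-suc-suc≤8 : binom (suc x) (suc y) ≤ 8 * X
        binom-suc-suc≤8 = *-cancelʳ-≤ _ _ (suc x * suc y) (begin
          binom (suc x) (suc y) * (suc x * suc y)          ≡⟨ binom-suc-suc x y ⟩
          X * (suc (x + y) * suc (suc (x + y)))            ≤⟨ *-monoʳ-≤ X (*-monoˡ-≤ (suc (suc (x + y))) (n≤1+n (suc (x + y)))) ⟩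
          X * (suc (suc (x + y)) * suc (suc (x + y)))      ≡⟨ cong (λ z → X * (z * z)) (sym (cong suc (+-suc x y))) ⟩
          X * ((suc x + suc y) * (suc x + suc y))          ≤⟨ *-monoʳ-≤ X (sum-square-≤ (suc x) (suc y)
                                                                (balanced (≤-trans (m∸n≤m k i) k≤t)) (balanced (≤-trans i≤k k≤t))) ⟩
          X * (8 * (suc x * suc y))                        ≡⟨ *-assoc X 8 _ ⟨
          X * 8 * (suc x * suc y)                          ≡⟨ cong (_* (suc x * suc y)) (*-comm X 8) ⟩
          8 * X * (suc x * suc y)                          ∎)

    X : ℕ → ℕ
    X i = binom (suc (k ∸ i + t)) (suc (i + t))

    S C : ℕ
    S = Σ (suc k) X
    C = gapSumCount v (suc (suc M)) (suc (suc M))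

    private
      Σ-pointwise : ∀ {f g} → (∀ i → i ≤ k → f i ≤ g i) → Σ (suc k) f ≤ Σ (suc k) g
      Σ-pointwise le = Σ-mono (suc k) (λ i i<k → le i (≤-pred i<k))

    C-lower : Up * S ≤ C
    C-lower = ≤-trans (≤-reflexive (sym (Σ-*ˡ (suc k) Up X)))
                      (Σ-pointwise (λ i i≤k → GapVector.steps-lower i i≤k))

    C-upper : k ≤ t → C ≤ (Up + 16) * S
    C-upper k≤t = ≤-trans (Σ-pointwise (λ i i≤k → GapVector.steps-upper i i≤k k≤t))
                          (≤-reflexive (Σ-*ˡ (suc k) (Up + 16) X))

    S-lower : suc k * R * U ≤ 2 ^ v * S * U + suc k * R * (v * (2 * suc k))
    S-lower = begin
      suc k * R * U                                              ≡⟨ *-assoc (suc k) R U ⟩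
      suc k * (R * U)                                            ≡⟨ Σ-const (suc k) (R * U) ⟨
      Σ (suc k) (λ _ → R * U)                                    ≤⟨ Σ-pointwise (λ i i≤k → GapVector.binom-ratio-lower i i≤k) ⟩
      Σ (suc k) (λ i → 2 ^ v * X i * U + R * vD)                 ≡⟨ Σ-+ (suc k) (λ i → 2 ^ v * X i * U) (λ _ → R * vD) ⟩
      Σ (suc k) (λ i → 2 ^ v * X i * U) + Σ (suc k) (λ _ → R * vD)
        ≡⟨ cong₂ _+_ (trans (Σ-*ʳ (suc k) U (λ i → 2 ^ v * X i)) (cong (_* U) (Σ-*ˡ (suc k) (2 ^ v) X)))
                     (trans (Σ-const (suc k) (R * vD)) (sym (*-assoc (suc k) R vD))) ⟩
      2 ^ v * S * U + suc k * R * vD                             ∎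
      where
      open ≤-Reasoning
      vD = v * (2 * suc k)

    S-upper : 2 ^ v * S * U ≤ suc k * R * U + 2 ^ v * S * (v * suc k)
    S-upper = begin
      2 ^ v * S * U                                              ≡⟨ cong (_* U) (Σ-*ˡ (suc k) (2 ^ v) X) ⟨
      Σ (suc k) (λ i → 2 ^ v * X i) * U                          ≡⟨ Σ-*ʳ (suc k) U (λ i → 2 ^ v * X i) ⟨
      Σ (suc k) (λ i → 2 ^ v * X i * U)                          ≤⟨ Σ-pointwise (λ i i≤k → GapVector.binom-ratio-upper i i≤k) ⟩
      Σ (suc k) (λ i → R * U + 2 ^ v * X i * vk)                 ≡⟨ Σ-+ (suc k) (λ _ → R * U) (λ i → 2 ^ v * X i * vk) ⟩
      Σ (suc k) (λ _ → R * U) + Σ (suc k) (λ i → 2 ^ v * X i * vk)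
        ≡⟨ cong₂ _+_ (trans (Σ-const (suc k) (R * U)) (sym (*-assoc (suc k) R U)))
                     (trans (Σ-*ʳ (suc k) vk (λ i → 2 ^ v * X i)) (cong (_* vk) (Σ-*ˡ (suc k) (2 ^ v) X))) ⟩
      suc k * R * U + 2 ^ v * S * vk                             ∎
      where
      open ≤-Reasoning
      vk = v * suc k

    K τ N : ℕ
    K = v * v + 20
    τ = suc (2 * M) * (M + 3)
    N = M * suc M

    -- In both polynomial inequalities the slack is the explicit polynomial with nonnegative
    -- coefficients in the ring identity.
    polynomial-lower : τ * M * U + Up * N * (v * (2 * suc k)) ≤ Up * N * U + τ * K * U
    polynomial-lower = begin
      τ * M * U + Up * N * vD                ≡⟨ factor τ M Up vD ⟩
      M * (τ * M * 2 + Up * suc M * vD)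
        ≤⟨ *-monoʳ-≤ M (≤-trans (m≤m+n (τ * M * 2 + Up * suc M * vD) _) (≤-reflexive (identity k t))) ⟩
      M * (Up * suc M * U + τ * K * 2)       ≡⟨ unfactor τ M Up K ⟩
      Up * N * U + τ * K * U                 ∎
      where
      open ≤-Reasoning
      vD = v * (2 * suc k)
      identity : ∀ k t →
        suc (2 * suc (suc (k + t))) * (suc (suc (k + t)) + 3) * suc (suc (k + t)) * 2
        + suc (suc (suc (k + t + t))) * suc (suc (suc (k + t))) * (suc (suc k) * (2 * suc k))
        + (1100 + 628 * t + 76 * t * t + 774 * k + 212 * k * t + 2 * k * t * t + 186 * k * k
           + 22 * k * k * t + 26 * k * k * k + 2 * k * k * k * t + 2 * k * k * k * k)
        ≡ suc (suc (suc (k + t + t))) * suc (suc (suc (k + t))) * (2 * suc (suc (k + t)))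
        + suc (2 * suc (suc (k + t))) * (suc (suc (k + t)) + 3) * (suc (suc k) * suc (suc k) + 20) * 2
      identity = solve-∀
      factor : ∀ τ M Up vD → τ * M * (2 * M) + Up * (M * suc M) * vD ≡ M * (τ * M * 2 + Up * suc M * vD)
      factor = solve-∀
      unfactor : ∀ τ M Up K → M * (Up * suc M * (2 * M) + τ * K * 2) ≡ Up * (M * suc M) * (2 * M) + τ * K * (2 * M)
      unfactor = solve-∀

    polynomial-upper : K ≤ M → (Up + 16) * N * U + τ * (M + K) * (v * suc k) ≤ τ * (M + K) * U
    polynomial-upper K≤M = begin
      (Up + 16) * N * U + τ * (M + K) * vk
        ≤⟨ +-monoˡ-≤ (τ * (M + K) * vk) (≤-trans (m≤m+n ((Up + 16) * N * U) _) (≤-reflexive (identity k t))) ⟩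
      τ * (2 * M * M + 40 * M) + τ * (M + K) * vk   ≡⟨ factor τ (2 * M * M + 40 * M) (M + K) vk ⟩
      τ * (2 * M * M + 40 * M + (M + K) * vk)
        ≤⟨ *-monoʳ-≤ τ (+-monoʳ-≤ (2 * M * M + 40 * M) (*-mono-≤ (+-monoʳ-≤ M K≤M) vk≤v*v)) ⟩
      τ * (2 * M * M + 40 * M + (M + M) * (v * v))  ≡⟨ cong (τ *_) (expand M (v * v)) ⟩
      τ * ((M + K) * U)                             ≡⟨ *-assoc τ (M + K) U ⟨
      τ * (M + K) * U                               ∎
      where
      open ≤-Reasoning
      vk = v * suc k
      vk≤v*v : vk ≤ v * v
      vk≤v*v = *-monoʳ-≤ v (n≤1+n (suc k))
      identity : ∀ k t →
        (suc (suc (suc (k + t + t))) + 16) * (suc (suc (k + t)) * suc (suc (suc (k + t)))) * (2 * suc (suc (k + t)))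
        + (1744 + 1864 * t + 616 * t * t + 60 * t * t * t + 1888 * k + 1264 * k * t + 194 * k * t * t
           + 2 * k * t * t * t + 648 * k * k + 208 * k * k * t + 6 * k * k * t * t + 74 * k * k * k
           + 6 * k * k * k * t + 2 * k * k * k * k)
        ≡ suc (2 * suc (suc (k + t))) * (suc (suc (k + t)) + 3) * (2 * suc (suc (k + t)) * suc (suc (k + t)) + 40 * suc (suc (k + t)))
      identity = solve-∀
      factor : ∀ τ x y z → τ * x + τ * y * z ≡ τ * (x + y * z)
      factor = solve-∀
      expand : ∀ M w → 2 * M * M + 40 * M + (M + M) * w ≡ (M + (w + 20)) * (2 * M)
      expand = solve-∀

    module _ (K≤t : K ≤ t) (T : ℕ) (T+≡ : T + binom (suc M) (suc M) ≡ pointCount (suc (suc M)) (suc (suc M))) where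
      private
        Q = suc k * R
        Q*τ≡ : Q * τ ≡ suc k * T * suc M
        Q*τ≡ = begin
          suc k * R * τ      ≡⟨ regroup (suc k) R τ ⟩
          suc k * (τ * R)    ≡⟨ cong (suc k *_) (multiset-size M T T+≡) ⟨
          suc k * (T * suc M) ≡⟨ *-assoc (suc k) T (suc M) ⟨
          suc k * T * suc M  ∎
          where
          open ≡-Reasoning
          regroup : ∀ a b c → a * b * c ≡ a * (c * b)
          regroup = solve-∀
        K≤M : K ≤ M
        K≤M = ≤-trans K≤t (≤-trans (m≤n+m t k) (≤-trans (n≤1+n _) (n≤1+n _)))
        k≤t : k ≤ t
        k≤t = ≤-trans (≤-trans (n≤1+n k) (≤-trans (n≤1+n (suc k)) (m≤m*n v v))) (≤-trans (m≤m+n (v * v) 20) K≤t)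

      relative-lower : suc k * T * M ≤ 2 ^ v * C * M + suc k * T * K
      relative-lower = *-cancelʳ-≤ _ _ (suc M) (begin
        suc k * T * M * suc M                 ≡⟨ swap (suc k * T) M (suc M) ⟩
        suc k * T * suc M * M                 ≡⟨ cong (_* M) Q*τ≡ ⟨
        Q * τ * M                             ≤⟨ combine-lower Up U M K (v * (2 * suc k)) τ Q (2 ^ v * S) (2 ^ v * C) N
                                                   Up*SZ≤W S-lower polynomial-lower ⟩
        2 ^ v * C * N + Q * τ * K             ≡⟨ cong (λ z → 2 ^ v * C * N + z * K) Q*τ≡ ⟩
        2 ^ v * C * N + suc k * T * suc M * K ≡⟨ collect (2 ^ v * C) M (suc M) (suc k * T) K ⟩
        (2 ^ v * C * M + suc k * T * K) * suc M ∎)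
        where
        open ≤-Reasoning
        swap : ∀ a b c → a * b * c ≡ a * c * b
        swap = solve-∀
        collect : ∀ W M N a K → W * (M * N) + a * N * K ≡ (W * M + a * K) * N
        collect = solve-∀
        Up*SZ≤W : Up * (2 ^ v * S) ≤ 2 ^ v * C
        Up*SZ≤W = ≤-trans (≤-reflexive (swap′ Up (2 ^ v) S)) (*-monoʳ-≤ (2 ^ v) C-lower)
          where
          swap′ : ∀ u p s → u * (p * s) ≡ p * (u * s)
          swap′ = solve-∀

      relative-upper : 2 ^ v * C * M ≤ suc k * T * (M + K)
      relative-upper = *-cancelʳ-≤ _ _ (suc M) (begin
        2 ^ v * C * M * suc M                 ≡⟨ *-assoc (2 ^ v * C) M (suc M) ⟩
        2 ^ v * C * N                         ≤⟨ combine-upper (Up + 16) U N (M + K) (v * suc k) τ Q (2 ^ v * S) (2 ^ v * C)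
                                                   W≤Up*SZ S-upper (polynomial-upper K≤M) ⟩
        Q * τ * (M + K)                       ≡⟨ cong (_* (M + K)) Q*τ≡ ⟩
        suc k * T * suc M * (M + K)           ≡⟨ swap (suc k * T) (suc M) (M + K) ⟩
        suc k * T * (M + K) * suc M           ∎)
        where
        open ≤-Reasoning
        swap : ∀ a b c → a * b * c ≡ a * c * b
        swap = solve-∀
        W≤Up*SZ : 2 ^ v * C ≤ (Up + 16) * (2 ^ v * S)
        W≤Up*SZ = ≤-trans (*-monoʳ-≤ (2 ^ v) (C-upper k≤t)) (≤-reflexive (swap′ (Up + 16) (2 ^ v) S))
          where
          swap′ : ∀ u p s → p * (u * s) ≡ u * (p * s)
          swap′ = solve-∀

  -- From the relative error bound K / M, with K (q + 1) < M, to the cross-multiplied form of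
  -- ∣ C / T − k / V ∣ < (p + 1) / (q + 1).
  relative⇒cross-multiplied : ∀ C T V k K M p q → 1 ≤ T → 1 ≤ k → .{{_ : NonZero M}} →
    k * T * M ≤ V * C * M + k * T * K → V * C * M ≤ k * T * (M + K) → K * suc q < M → k ≤ V →
    (C * V * suc q < suc p * (T * V) + k * T * suc q) × (k * T * suc q < suc p * (T * V) + C * V * suc q)
  relative⇒cross-multiplied C T V k K M p q 1≤T 1≤k lower upper Kq<M k≤V = below , above
    where
    open ≤-Reasoning
    kT = k * T
    kTKq<kTM : kT * (K * suc q) < kT * M
    kTKq<kTM = *-monoʳ-< kT {{>-nonZero (*-mono-≤ 1≤k 1≤T)}} Kq<M
    kTM≤ : kT * M ≤ suc p * (T * V) * M
    kTM≤ = begin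
      kT * M                ≤⟨ *-monoˡ-≤ M (*-monoˡ-≤ T k≤V) ⟩
      V * T * M             ≡⟨ cong (_* M) (*-comm V T) ⟩
      T * V * M             ≤⟨ *-monoˡ-≤ M (m≤n*m (T * V) (suc p)) ⟩
      suc p * (T * V) * M   ∎
    below : C * V * suc q < suc p * (T * V) + kT * suc q
    below = *-cancelʳ-< M _ _ (begin-strict
      C * V * suc q * M                         ≡⟨ regroup₁ C V (suc q) M ⟩
      V * C * M * suc q                         ≤⟨ *-monoˡ-≤ (suc q) upper ⟩
      kT * (M + K) * suc q                      ≡⟨ regroup₂ kT M K (suc q) ⟩
      kT * M * suc q + kT * (K * suc q)         <⟨ +-monoʳ-< (kT * M * suc q) kTKq<kTM ⟩
      kT * M * suc q + kT * M                   ≤⟨ +-monoʳ-≤ (kT * M * suc q) kTM≤ ⟩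
      kT * M * suc q + suc p * (T * V) * M      ≡⟨ regroup₃ kT M (suc q) (suc p * (T * V)) ⟩
      (suc p * (T * V) + kT * suc q) * M        ∎)
      where
      regroup₁ : ∀ C V q M → C * V * q * M ≡ V * C * M * q
      regroup₁ = solve-∀
      regroup₂ : ∀ a M K q → a * (M + K) * q ≡ a * M * q + a * (K * q)
      regroup₂ = solve-∀
      regroup₃ : ∀ a M q b → a * M * q + b * M ≡ (b + a * q) * M
      regroup₃ = solve-∀
    above : kT * suc q < suc p * (T * V) + C * V * suc q
    above = *-cancelʳ-< M _ _ (begin-strict
      kT * suc q * M                            ≡⟨ regroup₁ kT (suc q) M ⟩
      kT * M * suc q                            ≤⟨ *-monoˡ-≤ (suc q) lower ⟩
      (V * C * M + kT * K) * suc q              ≡⟨ regroup₂ V C M kT K (suc q) ⟩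
      V * C * M * suc q + kT * (K * suc q)      <⟨ +-monoʳ-< (V * C * M * suc q) kTKq<kTM ⟩
      V * C * M * suc q + kT * M                ≤⟨ +-monoʳ-≤ (V * C * M * suc q) kTM≤ ⟩
      V * C * M * suc q + suc p * (T * V) * M   ≡⟨ regroup₃ V C M (suc q) (suc p * (T * V)) ⟩
      (suc p * (T * V) + C * V * suc q) * M     ∎)
      where
      regroup₁ : ∀ a q M → a * q * M ≡ a * M * q
      regroup₁ = solve-∀
      regroup₂ : ∀ V C M a K q → (V * C * M + a * K) * q ≡ V * C * M * q + a * (K * q)
      regroup₂ = solve-∀
      regroup₃ : ∀ V C M q b → V * C * M * q + b * M ≡ (b + C * V * q) * M
      regroup₃ = solve-∀

open import Data.Nat using (ℕ; _≤_; _^_; _∸_)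
open import Data.Product using (_×_; ∃-syntax)
open import Data.Rational using (ℚ; 0ℚ; _<_; _-_; ∣_∣)
open import Relation.Binary.PropositionalEquality using (_≡_)

open import Data.Nat as ℕ using (zero; suc; _+_; _*_; z≤n; s≤s)
import Data.Nat.Properties as ℕ
open import Data.Nat.Tactic.RingSolver using (solve-∀)
open import Data.Integer as ℤ using (+_; +<+; -[1+_])
import Data.Integer.Properties as ℤ
import Data.Integer.Tactic.RingSolver as ℤ-Solver
open import Data.Rational as ℚ using (mkℚ; toℚᵘ; *<*)
import Data.Rational.Properties as ℚ
open import Algebra.Properties.Group ℚ.+-0-group using (⁻¹-anti-homo-//)
open import Data.Rational.Unnormalised as ℚᵘ using (mkℚᵘ)
import Data.Rational.Unnormalised.Properties as ℚᵘ
open import Data.Product using (_,_; proj₁; proj₂)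
open import Data.Sum using (inj₁; inj₂)
open import Data.List using (length)
open import Relation.Binary.PropositionalEquality using (refl; sym; trans; cong; subst; subst₂)
open Counting using (gapSumCount; countGap≡gapSumCount; length-gapSumMultiset)
open Asymptotics using (module Estimate; multiset-length; binom-pos; relative⇒cross-multiplied)

difference-<ℤ : ∀ a b c → b ℕ.< c + a → ℤ.- (+ a) ℤ.+ + b ℤ.< + c
difference-<ℤ a b c b<c+a = subst ((ℤ.- (+ a) ℤ.+ + b) ℤ.<_) cancel (ℤ.+-monoʳ-< (ℤ.- (+ a)) (+<+ b<c+a))
  where
  cancel : ℤ.- (+ a) ℤ.+ + (c + a) ≡ + c
  cancel = trans (cong (ℤ._+_ (ℤ.- (+ a))) (ℤ.pos-+ c a)) (identity (+ a) (+ c))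
    where
    identity : ∀ x y → ℤ.- x ℤ.+ (y ℤ.+ x) ≡ y
    identity = ℤ-Solver.solve-∀

pos-*³ : ∀ x y z → + (x * y * z) ≡ + x ℤ.* + y ℤ.* + z
pos-*³ x y z = trans (ℤ.pos-* (x * y) z) (cong (ℤ._* + z) (ℤ.pos-* x y))

toℚᵘ-ratio-difference : ∀ C t k w → toℚᵘ (ratio C (suc t) - ratio k (suc w)) ℚᵘ.≃ mkℚᵘ (+ C) t ℚᵘ.- mkℚᵘ (+ k) w
toℚᵘ-ratio-difference C t k w = ℚᵘ.≃-trans (ℚ.toℚᵘ-homo-+ (ratio C (suc t)) (ℚ.- ratio k (suc w)))
  (ℚᵘ.+-cong (ℚ.toℚᵘ-fromℚᵘ (mkℚᵘ (+ C) t))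
             (ℚᵘ.≃-trans (ℚ.toℚᵘ-homo‿- (ratio k (suc w))) (ℚᵘ.-‿cong (ℚ.toℚᵘ-fromℚᵘ (mkℚᵘ (+ k) w)))))

ratio-difference-< : ∀ C t k w p q (ε : ℚ) → toℚᵘ ε ≡ mkℚᵘ (+ suc p) q →
  C * suc w * suc q ℕ.< suc p * (suc t * suc w) + k * suc t * suc q →
  ratio C (suc t) - ratio k (suc w) < ε
ratio-difference-< C t k w p q ε ε≡ below = ℚ.toℚᵘ-cancel-<
  (ℚᵘ.<-respˡ-≃ (ℚᵘ.≃-sym (toℚᵘ-ratio-difference C t k w))
                (subst ((mkℚᵘ (+ C) t ℚᵘ.- mkℚᵘ (+ k) w) ℚᵘ.<_) (sym ε≡) (ℚᵘ.*<* numerator-below)))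
  where
  numerator-below : (+ C ℤ.* + suc w ℤ.+ ℤ.- (+ k) ℤ.* + suc t) ℤ.* + suc q ℤ.< + suc p ℤ.* + (suc t * suc w)
  numerator-below = subst₂ ℤ._<_ (sym (regroup (+ C) (+ suc w) (+ k) (+ suc t) (+ suc q))) (sym (ℤ.pos-* (suc p) (suc t * suc w)))
    (subst₂ (λ a b → ℤ.- a ℤ.+ b ℤ.< + (suc p * (suc t * suc w))) (pos-*³ k (suc t) (suc q)) (pos-*³ C (suc w) (suc q))
      (difference-<ℤ (k * suc t * suc q) (C * suc w * suc q) (suc p * (suc t * suc w)) below))
    where
    regroup : ∀ c w k t q → (c ℤ.* w ℤ.+ ℤ.- k ℤ.* t) ℤ.* q ≡ ℤ.- (k ℤ.* t ℤ.* q) ℤ.+ c ℤ.* w ℤ.* q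
    regroup = ℤ-Solver.solve-∀

ratio-close : ∀ C T k V p q (ε : ℚ) → toℚᵘ ε ≡ mkℚᵘ (+ suc p) q → 1 ≤ T → 1 ≤ V →
  C * V * suc q ℕ.< suc p * (T * V) + k * T * suc q →
  k * T * suc q ℕ.< suc p * (T * V) + C * V * suc q →
  ∣ ratio C T - ratio k V ∣ < ε
ratio-close C zero    k V       p q ε ε≡ () _ _ _
ratio-close C (suc t) k zero    p q ε ε≡ _ () _ _
ratio-close C (suc t) k (suc w) p q ε ε≡ _ _ below above with ℚ.∣p∣≡p∨∣p∣≡-p (ratio C (suc t) - ratio k (suc w))
... | inj₁ ∣x∣≡x  = subst (_< ε) (sym ∣x∣≡x) (ratio-difference-< C t k w p q ε ε≡ below)
... | inj₂ ∣x∣≡-x = subst (_< ε) (sym (trans ∣x∣≡-x (⁻¹-anti-homo-// (ratio C (suc t)) (ratio k (suc w)))))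
  (ratio-difference-< k w C t p q ε ε≡ (subst (λ z → k * suc t * suc q ℕ.< suc p * z + C * suc w * suc q)
                                               (ℕ.*-comm (suc t) (suc w)) above))

ratio-zero : ∀ b → ratio 0 b ≡ 0ℚ
ratio-zero zero    = refl
ratio-zero (suc b) = ℚ.0/n≡0 (suc b)

n<2^n : ∀ n → n ℕ.< 2 ^ n
n<2^n zero    = s≤s z≤n
n<2^n (suc n) = ℕ.+-mono-≤ (ℕ.m^n>0 2 n) (ℕ.≤-trans (n<2^n n) (ℕ.m≤m+n (2 ^ n) 0))

P-close : ∀ k t p q (ε : ℚ) → toℚᵘ ε ≡ mkℚᵘ (+ suc p) q → Estimate.K k t ≤ t → Estimate.K k t * suc q ℕ.< Estimate.M k t →
          ∣ P (suc (Estimate.M k t)) (suc (suc k)) - ratio (suc k) (2 ^ suc (suc k)) ∣ < ε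
P-close k t p q ε ε≡ K≤t Kq<M =
  subst (λ c → ∣ ratio c T - ratio (suc k) (2 ^ v) ∣ < ε) (sym (countGap≡gapSumCount (suc M) v))
    (ratio-close C T (suc k) (2 ^ v) p q ε ε≡ 1≤T (ℕ.m^n>0 2 v) below above)
  where
  open Estimate k t using (v; M; K; C; relative-lower; relative-upper)
  T = length (gapSumMultiset (suc M))
  T+≡ = length-gapSumMultiset (suc M)
  1≤T : 1 ≤ T
  1≤T = subst (1 ≤_) (sym (multiset-length M T T+≡)) (ℕ.≤-trans (binom-pos (suc M) (suc M)) (ℕ.m≤m+n _ _))
  k+1≤2^v : suc k ≤ 2 ^ v
  k+1≤2^v = ℕ.≤-trans (ℕ.n≤1+n (suc k)) (ℕ.<⇒≤ (n<2^n v))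
  bounds = relative⇒cross-multiplied C T (2 ^ v) (suc k) K M p q 1≤T (s≤s z≤n)
             (relative-lower K≤t T T+≡) (relative-upper K≤t T T+≡) Kq<M k+1≤2^v
  below = proj₁ bounds
  above = proj₂ bounds

P-eventually-close : ∀ k p q (ε : ℚ) → toℚᵘ ε ≡ mkℚᵘ (+ suc p) q →
  ∃[ N ] ((n : ℕ) → N ≤ n → ∣ P n (suc (suc k)) - ratio (suc k) (2 ^ suc (suc k)) ∣ < ε)
P-eventually-close k p q ε ε≡ = suc (Estimate.M k (K + K * suc q)) , close
  where
  K = Estimate.K k 0
  close : (n : ℕ) → suc (Estimate.M k (K + K * suc q)) ≤ n → ∣ P n (suc (suc k)) - ratio (suc k) (2 ^ suc (suc k)) ∣ < ε
  close n N≤n with ℕ.m≤n⇒∃[o]m+o≡n N≤n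
  ... | r , N+r≡n = subst (λ m → ∣ P m (suc (suc k)) - ratio (suc k) (2 ^ suc (suc k)) ∣ < ε)
                          (trans (shift-r k K (K * suc q) r) N+r≡n)
                          (P-close k t p q ε ε≡ (ℕ.m≤m+n K _) Kq<M)
    where
    t = K + (K * suc q + r)
    Kq<M : K * suc q ℕ.< Estimate.M k t
    Kq<M = s≤s (ℕ.≤-trans (ℕ.m≤m+n (K * suc q) r)
                  (ℕ.≤-trans (ℕ.m≤n+m _ K) (ℕ.≤-trans (ℕ.m≤n+m _ k) (ℕ.n≤1+n _))))
    shift-r : ∀ k a b r → suc (suc (suc (k + (a + (b + r))))) ≡ suc (suc (suc (k + (a + b)))) + r
    shift-r = solve-∀

P-short-gaps : ∀ n v → v ℕ.< 2 → P n v ≡ 0ℚ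
P-short-gaps n v v<2 =
  trans (cong (λ c → ratio c (length (gapSumMultiset n))) (trans (countGap≡gapSumCount n v) (no-gap-sum v v<2)))
        (ratio-zero (length (gapSumMultiset n)))
  where
  no-gap-sum : ∀ v → v ℕ.< 2 → gapSumCount v (suc n) (suc n) ≡ 0
  no-gap-sum zero          _ = refl
  no-gap-sum (suc zero)    _ = refl
  no-gap-sum (suc (suc v)) (s≤s (s≤s ()))

theorem1p4 : ((n : ℕ) → 1 ≤ n → (P n 0 ≡ 0ℚ) × (P n 1 ≡ 0ℚ))
    × ((v : ℕ) → 2 ≤ v → (ε : ℚ) → 0ℚ < ε →
        ∃[ N ] ((n : ℕ) → N ≤ n → ∣ P n v - ratio (v ∸ 1) (2 ^ v) ∣ < ε))
theorem1p4 = (λ n _ → P-short-gaps n 0 (s≤s z≤n) , P-short-gaps n 1 (s≤s (s≤s z≤n))) , convergence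
  where
  convergence : (v : ℕ) → 2 ≤ v → (ε : ℚ) → 0ℚ < ε →
                ∃[ N ] ((n : ℕ) → N ≤ n → ∣ P n v - ratio (v ∸ 1) (2 ^ v) ∣ < ε)
  convergence (suc (suc k)) (s≤s (s≤s z≤n)) ε@(mkℚ (+ suc p) q _) _ = P-eventually-close k p q ε refl
  convergence (suc (suc k)) (s≤s (s≤s z≤n)) (mkℚ (+ zero)   _ _) (*<* (+<+ ()))
  convergence (suc (suc k)) (s≤s (s≤s z≤n)) (mkℚ -[1+ _ ]   _ _) (*<* ())
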